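{- Let $m \geq 3$ be odd. Then, as $n \to \infty$, the number of independent sets of the discrete torus $\mathbb{Z}_m^n$ satisfies \[ |\mathcal{I}(\mathbb{Z}_m^n)| \geq 2^{\lfloor m/2 \rfloor m^{n-1}} \cdot \exp\big( (1-o(1)) (m/2)^{n-1} \big). \]
   Context: For $m,n\in\mathbb{N}$, the discrete torus $\mathbb{Z}_m^n$ is the graph with vertex set $\{0,1,\ldots,m-1\}^n$ in which $u,v$ are adjacent iff there is $j\in[n]$ with $u_j \equiv v_j \pm 1 \pmod m$ and $u_i=v_i$ for all $i\neq j$. $\mathcal{I}(G)$ is the set of independent sets of a graph $G$. $o(1)$ denotes a quantity tending to $0$ as $n\to\infty$ (with $m$ fixed). -}

module Defs where

open import Data.Nat as ℕ using (ℕ; zero; suc; NonZero; _%_; _!)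
open import Data.Nat.Properties using (_!≢0)
open import Data.Fin using (Fin; toℕ)
open import Data.Fin.Properties using (any?; all?; _≟_)
open import Data.Vec using (Vec; []; _∷_; lookup)
open import Data.List using (List; []; _∷_; _++_; map; concatMap; allFin; length; filter)
open import Data.List.Relation.Unary.All using (All)
import Data.List.Relation.Unary.All as All
open import Data.Product using (Σ; _×_; ∃-syntax)
open import Data.Product.Properties using ()
open import Data.Sum using (_⊎_)
open import Relation.Binary.PropositionalEquality using (_≡_; _≢_)
open import Relation.Nullary using (¬_; Dec)
open import Relation.Nullary.Decidable using (_×-dec_; _⊎-dec_; _→-dec_; ¬?)
open import Data.Integer using (+_)
open import Data.Rational using (ℚ; _/_; 0ℚ; 1ℚ; _+_; _*_)
import Data.Nat as N

Vertex : ℕ → ℕ → Set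
Vertex m n = Vec (Fin m) n

PlusMinusOne : (m : ℕ) .{{_ : NonZero m}} → Fin m → Fin m → Set
PlusMinusOne m a b =
  (toℕ a ≡ (toℕ b N.+ 1) % m) ⊎ (toℕ b ≡ (toℕ a N.+ 1) % m)

Adjacent : (m n : ℕ) .{{_ : NonZero m}} → Vertex m n → Vertex m n → Set
Adjacent m n u v =
  ∃[ j ] (PlusMinusOne m (lookup u j) (lookup v j)
          × (∀ i → i ≢ j → lookup u i ≡ lookup v i))

IsIndependent : (m n : ℕ) .{{_ : NonZero m}} → List (Vertex m n) → Set
IsIndependent m n S = All (λ u → All (λ v → ¬ Adjacent m n u v) S) S

adjacent? : (m n : ℕ) .{{_ : NonZero m}} → (u v : Vertex m n) → Dec (Adjacent m n u v)
adjacent? m n u v = any? λ j →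
  ((toℕ (lookup u j) Data.Nat.≟ (toℕ (lookup v j) N.+ 1) % m)
     ⊎-dec (toℕ (lookup v j) Data.Nat.≟ (toℕ (lookup u j) N.+ 1) % m))
  ×-dec all? (λ i → ¬? (i ≟ j) →-dec (lookup u i ≟ lookup v i))
  where import Data.Nat

isIndependent? : (m n : ℕ) .{{_ : NonZero m}} → (S : List (Vertex m n)) → Dec (IsIndependent m n S)
isIndependent? m n S = All.all? (λ u → All.all? (λ v → ¬? (adjacent? m n u v)) S) S

allVertices : (m n : ℕ) → List (Vertex m n)
allVertices m zero = [] ∷ []
allVertices m (suc n) = concatMap (λ x → map (x ∷_) (allVertices m n)) (allFin m)

subsets : ∀ {A : Set} → List A → List (List A)
subsets [] = [] ∷ []
subsets (x ∷ xs) = subsets xs ++ map (x ∷_) (subsets xs)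

numIndep : (m n : ℕ) .{{_ : NonZero m}} → ℕ
numIndep m n = length (filter (isIndependent? m n) (subsets (allVertices m n)))

_^ℚ_ : ℚ → ℕ → ℚ
x ^ℚ zero = 1ℚ
x ^ℚ suc k = x * (x ^ℚ k)

expPartial : ℕ → ℚ → ℚ
expPartial zero x = 0ℚ
expPartial (suc K) x = expPartial K x + (x ^ℚ K) * ((+ 1) / (K !)) {{K !≢0}}

{-# OPTIONS --safe #-}
-- Group the vertices of ℤ_m^n by their level, the coordinate sum modulo m: adjacent vertices
-- lie on consecutive levels, and a vertex has at most n neighbours one level below it and at
-- most n one level above it. The even levels 0, 2, …, m − 3 form an independent set B of size
-- ⌊m/2⌋ m^(n-1), which alone gives 2^|B| independent sets. Placing the levels P = m − 2 and
-- Q = m − 1 on top, a vertex of P or Q has at most n neighbours in each layer below it, so it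
-- multiplies the count by at least 1 + μ resp. 1 + ν, with μ = 2^-n and ν ≈ (1 − ε) 2^-n.
-- For r = (1 − ε) 2^-n we have (1 + μ)(1 − r) ≥ 1 and (1 + ν)(1 − r) ≥ 1, so the gain is at
-- least (1 − r)^(-2 m^(n-1)), which dominates exp(2 m^(n-1) r) = exp((1 − ε)(m/2)^(n-1)): the
-- exponential series is dominated term by term by the negative binomial series of (1 − r)^(-L).
module Submission where

open import Algebra.Bundles using (Ring; CommutativeRing)
open import Data.Bool using (Bool; true; false; _∧_; not; T; if_then_else_)
open import Data.Bool.Properties using (T-∧; T-≡; ∧-comm; ∧-identityʳ; ∧-idempotentCommutativeMonoid)
open import Data.Empty using (⊥; ⊥-elim)
open import Data.Fin as Fin using (Fin; toℕ; fromℕ<)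
import Data.Fin.Properties as Fin
import Data.Integer as ℤ
import Data.Integer.Tactic.RingSolver as ℤ-Solver
open import Data.List using (List; []; _∷_; _++_; map; concatMap; filter; filterᵇ; length; allFin; downFrom)
open import Data.List.Properties
  using (filter-++; length-++; filter-≐; filter-none; filter-all; filter-some; filter-accept; filter-reject;
         length-map; length-tabulate)
open import Data.List.Membership.Propositional using (_∈_)
open import Data.List.Membership.Propositional.Properties
  using (∈-∃++; ∈-++⁻; ∈-++⁺ˡ; ∈-++⁺ʳ; ∈-filter⁻; ∈-map⁺; ∈-map⁻; ∈-allFin)
open import Data.List.Relation.Binary.Permutation.Propositional as ↭ using (_↭_; ↭-refl; ↭-sym; ↭-trans)
open import Data.List.Relation.Binary.Permutation.Propositional.Properties using (shift; ++⁺ˡ)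
open import Data.List.Relation.Unary.All as All using (All; []; _∷_)
import Data.List.Relation.Unary.All.Properties as All
open import Data.List.Relation.Unary.AllPairs as AllPairs using ([]; _∷_)
import Data.List.Relation.Unary.AllPairs.Properties as AllPairs
open import Data.List.Relation.Unary.Any as Any using (here; there)
open import Data.List.Relation.Unary.Unique.Propositional using (Unique)
import Data.List.Relation.Unary.Unique.Propositional.Properties as Unique
open import Data.Nat as ℕ using (ℕ; zero; suc; NonZero; z≤n; s≤s; _!)
import Data.Nat.Properties as ℕ
open import Data.Nat.Properties using (_!≢0)
open import Data.Nat.DivMod
  using (%-distribˡ-+; m%n%n≡m%n; n%n≡0; %-remove-+ʳ; [m+n]%n≡m%n; m<n⇒m%n≡m; m%n<n; m≡m%n+[m/n]*n; m*n%n≡0)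
open import Data.Nat.Divisibility using (_∣_; m%n≡0⇒n∣m)
import Data.Nat.Tactic.RingSolver as ℕ-Solver
open import Data.Product using (_×_; _,_; proj₁; proj₂; uncurry; Σ-syntax; ∃-syntax)
open import Data.Rational as ℚ using (ℚ; mkℚ; 0ℚ; 1ℚ; toℚᵘ)
import Data.Rational.Properties as ℚ
open import Data.Rational.Solver using (module +-*-Solver)
import Data.Rational.Unnormalised as ℚᵘ
import Data.Rational.Unnormalised.Properties as ℚᵘ
open import Data.Sum as Sum using (_⊎_; inj₁; inj₂; [_,_]′)
open import Data.Vec as Vec using (Vec; lookup; _[_]≔_)
import Data.Vec.Properties as Vec
open import Function using (_∘_; id; _⇔_; mk⇔; Equivalence)
open import Level using (0ℓ)
open import Relation.Binary.PropositionalEquality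
open import Relation.Nullary using (¬_; Dec; yes; no; does)
open import Relation.Nullary.Decidable using (isYes; _×-dec_; ¬?; T?; toWitnessFalse; fromWitnessFalse)
open import Relation.Unary using (Pred; Decidable)
open import Defs

open Equivalence using (to; from)

module _ where
  open import Data.Nat using (_+_; _*_; _≤_)

  length-filter-map : ∀ {A B : Set} {P : B → Set} (P? : Decidable P) (f : A → B) xs →
                      length (filter P? (map f xs)) ≡ length (filter (P? ∘ f) xs)
  length-filter-map P? f []       = refl
  length-filter-map P? f (x ∷ xs) with does (P? (f x))
  ... | true  = cong suc (length-filter-map P? f xs)
  ... | false = length-filter-map P? f xs

  length-filter-concatMap : ∀ {A B : Set} {P : A → Set} (P? : Decidable P) (f : B → List A) {k} xs →
    (∀ x → length (filter P? (f x)) ≡ k) → length (filter P? (concatMap f xs)) ≡ length xs * k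
  length-filter-concatMap P? f []       each = refl
  length-filter-concatMap P? f {k} (x ∷ xs) each = begin
    length (filter P? (f x ++ concatMap f xs))                      ≡⟨ cong length (filter-++ P? (f x) _) ⟩
    length (filter P? (f x) ++ filter P? (concatMap f xs))          ≡⟨ length-++ (filter P? (f x)) ⟩
    length (filter P? (f x)) + length (filter P? (concatMap f xs))  ≡⟨ cong₂ _+_ (each x) (length-filter-concatMap P? f xs each) ⟩
    k + length xs * k                                               ∎
    where open ≡-Reasoning

  length-filter-⊎ : ∀ {A : Set} {P Q R : A → Set} (P? : Decidable P) (Q? : Decidable Q) (R? : Decidable R) →
    (∀ {x} → R x → P x ⊎ Q x) → (∀ {x} → P x → R x) → (∀ {x} → Q x → R x) → (∀ {x} → P x → ¬ Q x) →
    ∀ xs → length (filter R? xs) ≡ length (filter P? xs) + length (filter Q? xs)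
  length-filter-⊎ P? Q? R? R⇒P⊎Q P⇒R Q⇒R P⇒¬Q []       = refl
  length-filter-⊎ P? Q? R? R⇒P⊎Q P⇒R Q⇒R P⇒¬Q (x ∷ xs)
    with ih ← length-filter-⊎ P? Q? R? R⇒P⊎Q P⇒R Q⇒R P⇒¬Q xs | P? x | Q? x | R? x
  ... | yes p | yes q | _     = ⊥-elim (P⇒¬Q p q)
  ... | yes p | no _  | no ¬r = ⊥-elim (¬r (P⇒R p))
  ... | no _  | yes q | no ¬r = ⊥-elim (¬r (Q⇒R q))
  ... | no ¬p | no ¬q | yes r = ⊥-elim ([ ¬p , ¬q ]′ (R⇒P⊎Q r))
  ... | yes _ | no _  | yes _ = cong suc ih
  ... | no _  | yes _ | yes _ = trans (cong suc ih) (sym (ℕ.+-suc _ _))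
  ... | no _  | no _  | no _  = ih

  Unique-⊆⇒length-≤ : ∀ {A : Set} {xs ys : List A} → Unique xs → (∀ {z} → z ∈ xs → z ∈ ys) →
                      length xs ≤ length ys
  Unique-⊆⇒length-≤ {xs = []}     _              _     = z≤n
  Unique-⊆⇒length-≤ {xs = x ∷ xs} (x∉xs ∷ unique) xs⊆ys with ∈-∃++ (xs⊆ys (here refl))
  ... | as , bs , refl = begin
    suc (length xs)                ≤⟨ s≤s (Unique-⊆⇒length-≤ unique (λ z∈xs →
                                         remove (xs⊆ys (there z∈xs)) (λ z≡x → All.lookup x∉xs z∈xs (sym z≡x)))) ⟩
    suc (length (as ++ bs))        ≡⟨ cong suc (length-++ as) ⟩
    suc (length as + length bs)    ≡⟨ ℕ.+-suc (length as) (length bs) ⟨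
    length as + length (x ∷ bs)    ≡⟨ length-++ as ⟨
    length (as ++ x ∷ bs)          ∎
    where
    open ℕ.≤-Reasoning
    remove : ∀ {z} → z ∈ as ++ x ∷ bs → z ≢ x → z ∈ as ++ bs
    remove z∈ z≢x with ∈-++⁻ as z∈
    ... | inj₁ z∈as         = ∈-++⁺ˡ z∈as
    ... | inj₂ (here z≡x)   = ⊥-elim (z≢x z≡x)
    ... | inj₂ (there z∈bs) = ∈-++⁺ʳ as z∈bs

  module _ {A : Set} {P Q R : Pred A 0ℓ} (P? : Decidable P) (Q? : Decidable Q) (R? : Decidable R)
           (P⇒¬Q : ∀ {x} → P x → ¬ Q x) (P⇒¬R : ∀ {x} → P x → ¬ R x) (Q⇒¬R : ∀ {x} → Q x → ¬ R x) where

    none? : Decidable (λ x → ¬ P x × ¬ Q x × ¬ R x)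
    none? x = ¬? (P? x) ×-dec ¬? (Q? x) ×-dec ¬? (R? x)

    ↭-partition : ∀ xs → xs ↭ filter P? xs ++ filter Q? xs ++ filter R? xs ++ filter none? xs
    ↭-partition []       = ↭-refl
    ↭-partition (x ∷ xs) with ih ← ↭-partition xs | P? x | Q? x | R? x
    ... | yes p | yes q | _     = ⊥-elim (P⇒¬Q p q)
    ... | yes p | no _  | yes r = ⊥-elim (P⇒¬R p r)
    ... | no _  | yes q | yes r = ⊥-elim (Q⇒¬R q r)
    ... | yes _ | no _  | no _  = ↭.prep x ih
    ... | no _  | yes _ | no _  = ↭-trans (↭.prep x ih) (↭-sym (shift x (filter P? xs) _))
    ... | no _  | no _  | yes _ = ↭-trans (↭.prep x ih) (↭-sym (↭-trans
          (++⁺ˡ (filter P? xs) (shift x (filter Q? xs) _)) (shift x (filter P? xs) _)))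
    ... | no _  | no _  | no _  = ↭-trans (↭.prep x ih) (↭-sym (↭-trans
          (++⁺ˡ (filter P? xs) (++⁺ˡ (filter Q? xs) (shift x (filter R? xs) _))) (↭-trans
          (++⁺ˡ (filter P? xs) (shift x (filter Q? xs) _)) (shift x (filter P? xs) _))))

module _ where
  open import Data.Integer using (+_)
  open import Data.Rational using (_+_; _*_; _-_; _≤_)
  open import Data.Rational.Properties
  open import Algebra.Definitions.RawMonoid ℚ.+-0-rawMonoid using () renaming (_×_ to _×ℚ_)
  open import Algebra.Properties.Monoid.Mult +-0-monoid using (×-homo-+)
  open import Algebra.Properties.Semiring.Mult (Ring.semiring +-*-ring) using (×1-homo-*)
  open import Algebra.Properties.CommutativeSemigroup (CommutativeRing.*-commutativeSemigroup +-*-commutativeRing)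
    using (interchange)

  ι : ℕ → ℚ
  ι n = + n ℚ./ 1

  ι-suc : ∀ n → ι (suc n) ≡ 1ℚ + ι n
  ι-suc n = toℚᵘ-injective (begin
    toℚᵘ (ι (suc n))                     ≈⟨ toℚᵘ-fromℚᵘ (ℚᵘ.mkℚᵘ (+ suc n) 0) ⟩
    ℚᵘ.mkℚᵘ (+ suc n) 0                  ≈⟨ ℚᵘ.*≡* (solve (+ n)) ⟩
    ℚᵘ.mkℚᵘ (+ 1) 0 ℚᵘ.+ ℚᵘ.mkℚᵘ (+ n) 0 ≈⟨ ℚᵘ.+-congʳ _ (ℚᵘ.≃-sym (toℚᵘ-fromℚᵘ (ℚᵘ.mkℚᵘ (+ n) 0))) ⟩
    toℚᵘ 1ℚ ℚᵘ.+ toℚᵘ (ι n)              ≈⟨ ℚᵘ.≃-sym (toℚᵘ-homo-+ 1ℚ (ι n)) ⟩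
    toℚᵘ (1ℚ + ι n)                      ∎)
    where
    open ℚᵘ.≃-Reasoning
    solve : ∀ x → (+ 1 ℤ.+ x) ℤ.* + 1 ≡ (+ 1 ℤ.* + 1 ℤ.+ x ℤ.* + 1) ℤ.* + 1
    solve = ℤ-Solver.solve-∀

  -- ι is the embedding n ↦ n × 1 of the semiring ℚ, whose homomorphism laws are in the library
  ι≡×1 : ∀ n → ι n ≡ n ×ℚ 1ℚ
  ι≡×1 zero    = refl
  ι≡×1 (suc n) = trans (ι-suc n) (cong (λ q → 1ℚ + q) (ι≡×1 n))

  ι-+ : ∀ a b → ι (a ℕ.+ b) ≡ ι a + ι b
  ι-+ a b rewrite ι≡×1 (a ℕ.+ b) | ι≡×1 a | ι≡×1 b = ×-homo-+ 1ℚ a b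

  ι-* : ∀ a b → ι (a ℕ.* b) ≡ ι a * ι b
  ι-* a b rewrite ι≡×1 (a ℕ.* b) | ι≡×1 a | ι≡×1 b = ×1-homo-* a b

  0≤ι : ∀ n → 0ℚ ≤ ι n
  0≤ι n = nonNegative⁻¹ (ι n) {{normalize-nonNeg n 1}}

  ι-mono-≤ : ∀ {a b} → a ℕ.≤ b → ι a ≤ ι b
  ι-mono-≤ {a} a≤b with ℕ.m≤n⇒∃[o]m+o≡n a≤b
  ... | c , refl = begin
    ι a         ≡⟨ +-identityʳ (ι a) ⟨
    ι a + 0ℚ    ≤⟨ +-monoʳ-≤ (ι a) (0≤ι c) ⟩
    ι a + ι c   ≡⟨ ι-+ a c ⟨
    ι (a ℕ.+ c) ∎
    where open ≤-Reasoning

  ι-^ : ∀ a k → ι (a ℕ.^ k) ≡ ι a ^ℚ k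
  ι-^ a zero    = refl
  ι-^ a (suc k) = trans (ι-* a (a ℕ.^ k)) (cong (ι a *_) (ι-^ a k))

  0≤1 : 0ℚ ≤ 1ℚ
  0≤1 = 0≤ι 1

  *-monoˡ-≤-≥0 : ∀ {r p q} → 0ℚ ≤ r → p ≤ q → r * p ≤ r * q
  *-monoˡ-≤-≥0 {r} 0≤r = *-monoˡ-≤-nonNeg r {{ℚ.nonNegative 0≤r}}

  *-monoʳ-≤-≥0 : ∀ {r p q} → 0ℚ ≤ r → p ≤ q → p * r ≤ q * r
  *-monoʳ-≤-≥0 {r} 0≤r = *-monoʳ-≤-nonNeg r {{ℚ.nonNegative 0≤r}}

  *-mono-≤-≥0 : ∀ {p q r s} → 0ℚ ≤ p → 0ℚ ≤ r → p ≤ q → r ≤ s → p * r ≤ q * s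
  *-mono-≤-≥0 0≤p 0≤r p≤q r≤s = ≤-trans (*-monoˡ-≤-≥0 0≤p r≤s) (*-monoʳ-≤-≥0 (≤-trans 0≤r r≤s) p≤q)

  *-≥0 : ∀ {p q} → 0ℚ ≤ p → 0ℚ ≤ q → 0ℚ ≤ p * q
  *-≥0 {p} {q} 0≤p 0≤q = subst (_≤ p * q) (*-zeroʳ p) (*-monoˡ-≤-≥0 0≤p 0≤q)

  ^ℚ-+ : ∀ x a b → x ^ℚ (a ℕ.+ b) ≡ x ^ℚ a * x ^ℚ b
  ^ℚ-+ x zero    b = sym (*-identityˡ (x ^ℚ b))
  ^ℚ-+ x (suc a) b = trans (cong (x *_) (^ℚ-+ x a b)) (sym (*-assoc x (x ^ℚ a) (x ^ℚ b)))

  *-^ℚ : ∀ x y k → (x * y) ^ℚ k ≡ x ^ℚ k * y ^ℚ k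
  *-^ℚ x y zero    = refl
  *-^ℚ x y (suc k) = trans (cong ((x * y) *_) (*-^ℚ x y k)) (interchange x y (x ^ℚ k) (y ^ℚ k))

  ^ℚ-≥0 : ∀ {x} k → 0ℚ ≤ x → 0ℚ ≤ x ^ℚ k
  ^ℚ-≥0 zero    0≤x = 0≤1
  ^ℚ-≥0 (suc k) 0≤x = *-≥0 0≤x (^ℚ-≥0 k 0≤x)

  1≤^ℚ : ∀ {x} k → 1ℚ ≤ x → 1ℚ ≤ x ^ℚ k
  1≤^ℚ zero    1≤x = ≤-refl
  1≤^ℚ (suc k) 1≤x = *-mono-≤-≥0 0≤1 0≤1 1≤x (1≤^ℚ k 1≤x)

  ^ℚ-monoʳ-≤ : ∀ {x} {a b} → 1ℚ ≤ x → a ℕ.≤ b → x ^ℚ a ≤ x ^ℚ b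
  ^ℚ-monoʳ-≤ {x} {a} 1≤x a≤b with ℕ.m≤n⇒∃[o]m+o≡n a≤b
  ... | c , refl = begin
    x ^ℚ a             ≡⟨ *-identityʳ (x ^ℚ a) ⟨
    x ^ℚ a * 1ℚ        ≤⟨ *-monoˡ-≤-≥0 (^ℚ-≥0 a (≤-trans 0≤1 1≤x)) (1≤^ℚ c 1≤x) ⟩
    x ^ℚ a * x ^ℚ c    ≡⟨ ^ℚ-+ x a c ⟨
    x ^ℚ (a ℕ.+ c)     ∎
    where open ≤-Reasoning

  ^ℚ-shift : ∀ {a} {s s′} d → 1ℚ ≤ a → s ℕ.≤ s′ ℕ.+ d → a ^ℚ s ≤ a ^ℚ s′ * a ^ℚ d
  ^ℚ-shift {a} {s} {s′} d 1≤a s≤s′+d = ≤-trans (^ℚ-monoʳ-≤ 1≤a s≤s′+d) (≤-reflexive (^ℚ-+ a s′ d))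

  p≤p+q : ∀ {p q} → 0ℚ ≤ q → p ≤ p + q
  p≤p+q {p} 0≤q = ≤-trans (≤-reflexive (sym (+-identityʳ p))) (+-monoʳ-≤ p 0≤q)

  p≤q⇒0≤q-p : ∀ {p q} → p ≤ q → 0ℚ ≤ q - p
  p≤q⇒0≤q-p {p} p≤q = ≤-trans (≤-reflexive (sym (+-inverseʳ p))) (+-monoˡ-≤ (ℚ.- p) p≤q)

  /-*-ι : ∀ a d .{{_ : NonZero d}} → (+ a ℚ./ d) * ι d ≡ ι a
  /-*-ι a (suc d) = toℚᵘ-injective (begin
    toℚᵘ ((+ a ℚ./ suc d) * ι (suc d))         ≈⟨ toℚᵘ-homo-* (+ a ℚ./ suc d) (ι (suc d)) ⟩
    toℚᵘ (+ a ℚ./ suc d) ℚᵘ.* toℚᵘ (ι (suc d)) ≈⟨ ℚᵘ.*-cong (toℚᵘ-fromℚᵘ (ℚᵘ.mkℚᵘ (+ a) d))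
                                                             (toℚᵘ-fromℚᵘ (ℚᵘ.mkℚᵘ (+ suc d) 0)) ⟩
    ℚᵘ.mkℚᵘ (+ a) d ℚᵘ.* ℚᵘ.mkℚᵘ (+ suc d) 0   ≈⟨ ℚᵘ.*≡* (trans (solve (+ a) (+ suc d))
                                                            (cong (λ k → + a ℤ.* + suc k) (sym (ℕ.*-identityʳ d)))) ⟩
    ℚᵘ.mkℚᵘ (+ a) 0                            ≈⟨ ℚᵘ.≃-sym (toℚᵘ-fromℚᵘ (ℚᵘ.mkℚᵘ (+ a) 0)) ⟩
    toℚᵘ (ι a)                                 ∎)
    where
    open ℚᵘ.≃-Reasoning
    solve : ∀ x y → (x ℤ.* y) ℤ.* + 1 ≡ x ℤ.* y
    solve = ℤ-Solver.solve-∀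

  ι-pos : ∀ d .{{_ : NonZero d}} → ℚ.Positive (ι d)
  ι-pos d = normalize-pos d 1

  *-cancelʳ-≡ : ∀ {p q} r .{{_ : ℚ.Positive r}} → p * r ≡ q * r → p ≡ q
  *-cancelʳ-≡ r pr≡qr = ≤-antisym (*-cancelʳ-≤-pos r (≤-reflexive pr≡qr)) (*-cancelʳ-≤-pos r (≤-reflexive (sym pr≡qr)))

  fact⁻¹ : ℕ → ℚ
  fact⁻¹ K = (+ 1 ℚ./ K !) {{K !≢0}}

  0≤fact⁻¹ : ∀ K → 0ℚ ≤ fact⁻¹ K
  0≤fact⁻¹ K = nonNegative⁻¹ (fact⁻¹ K) {{normalize-nonNeg 1 (K !) {{K !≢0}}}}

  fact⁻¹-suc : ∀ K → ι (suc K) * fact⁻¹ (suc K) ≡ fact⁻¹ K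
  fact⁻¹-suc K = *-cancelʳ-≡ (ι (K !)) {{ι-pos (K !) {{K !≢0}}}} (begin
    (ι (suc K) * fact⁻¹ (suc K)) * ι (K !)  ≡⟨ *-assoc (ι (suc K)) _ _ ⟩
    ι (suc K) * (fact⁻¹ (suc K) * ι (K !))  ≡⟨ *-comm (ι (suc K)) _ ⟩
    (fact⁻¹ (suc K) * ι (K !)) * ι (suc K)  ≡⟨ *-assoc (fact⁻¹ (suc K)) _ _ ⟩
    fact⁻¹ (suc K) * (ι (K !) * ι (suc K))  ≡⟨ cong (fact⁻¹ (suc K) *_) (trans (*-comm (ι (K !)) _) (sym (ι-* (suc K) (K !)))) ⟩
    fact⁻¹ (suc K) * ι (suc K !)            ≡⟨ /-*-ι 1 (suc K !) {{suc K !≢0}} ⟩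
    1ℚ                                      ≡⟨ /-*-ι 1 (K !) {{K !≢0}} ⟨
    fact⁻¹ K * ι (K !)                      ∎)
    where open ≡-Reasoning

-- Counting independent sets of a graph with decidable adjacency

module IndependentSets {V : Set} {_~_ : V → V → Set} (_~?_ : ∀ u v → Dec (u ~ v)) where
  open import Data.Nat using (_+_; _≤_)
  open import Algebra.Solver.IdempotentCommutativeMonoid ∧-idempotentCommutativeMonoid using (solve; _⊕_; _⊜_)

  Independent : List V → Set
  Independent S = All (λ u → All (λ v → ¬ u ~ v) S) S

  Apart : V → List V → Set
  Apart x = All (λ v → ¬ x ~ v × ¬ v ~ x)

  Independent-∷⁻ : ∀ {x S} → Independent (x ∷ S) → ¬ x ~ x × Apart x S × Independent S
  Independent-∷⁻ ((¬x~x ∷ row) ∷ rows) =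
    ¬x~x , All.zip (row , All.map All.head rows) , All.map All.tail rows

  Independent-∷⁺ : ∀ {x S} → ¬ x ~ x → Apart x S → Independent S → Independent (x ∷ S)
  Independent-∷⁺ ¬x~x apart ind with All.unzip apart
  ... | row , column = (¬x~x ∷ row) ∷ All.zipWith (uncurry _∷_) (column , ind)

  _~ᵇ_ _≁ᵇ_ : V → V → Bool
  u ~ᵇ v = isYes (u ~? v)
  u ≁ᵇ v = not (u ~ᵇ v) ∧ not (v ~ᵇ u)

  _∖N_ : (V → Bool) → V → (V → Bool)
  (A ∖N x) v = A v ∧ x ≁ᵇ v

  guard : Bool → ℕ → ℕ
  guard b k = if b then k else 0

  -- the number of independent subsets of L contained in the set A of allowed vertices
  indepCount : List V → (V → Bool) → ℕ
  indepCount []      A = 1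
  indepCount (x ∷ L) A = indepCount L A + guard (A x ∧ not (x ~ᵇ x)) (indepCount L (A ∖N x))

  T-≁ᵇ : ∀ {x v} → T (x ≁ᵇ v) ⇔ (¬ x ~ v × ¬ v ~ x)
  T-≁ᵇ {x} {v} = mk⇔
    (λ t → let a , b = to T-∧ t in toWitnessFalse {a? = x ~? v} a , toWitnessFalse {a? = v ~? x} b)
    (λ (a , b) → from T-∧ (fromWitnessFalse {a? = x ~? v} a , fromWitnessFalse {a? = v ~? x} b))

  All-∖N : ∀ {A x S} → All (T ∘ (A ∖N x)) S ⇔ (All (T ∘ A) S × Apart x S)
  All-∖N = mk⇔ (All.unzip ∘ All.map (λ t → let a , b = to T-∧ t in a , to T-≁ᵇ b))
               (All.map (λ (a , b) → from T-∧ (a , from T-≁ᵇ b)) ∘ All.zip)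

  Within : (V → Bool) → List V → Set
  Within A S = Independent S × All (T ∘ A) S

  within? : ∀ A → Decidable (Within A)
  within? A S = All.all? (λ u → All.all? (λ v → ¬? (u ~? v)) S) S ×-dec All.all? (T? ∘ A) S

  Within-∷ : ∀ {A x S} → Within A (x ∷ S) ⇔ (T (A x ∧ not (x ~ᵇ x)) × Within (A ∖N x) S)
  Within-∷ {A} {x} = mk⇔
    (λ { (ind , Ax ∷ AS) → let ¬x~x , apart , indS = Independent-∷⁻ ind in
      from T-∧ (Ax , fromWitnessFalse ¬x~x) , indS , from All-∖N (AS , apart) })
    (λ (t , indS , A∖S) → let Ax , x≁x = to T-∧ t ; AS , apart = to All-∖N A∖S in
      Independent-∷⁺ (toWitnessFalse {a? = x ~? x} x≁x) apart indS , Ax ∷ AS)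

  count-Within : ∀ L A → length (filter (within? A) (subsets L)) ≡ indepCount L A
  count-Within []      A = refl
  count-Within (x ∷ L) A = begin
    length (filter (within? A) (subsets L ++ map (x ∷_) (subsets L)))
      ≡⟨ cong length (filter-++ (within? A) (subsets L) _) ⟩
    length (filter (within? A) (subsets L) ++ filter (within? A) (map (x ∷_) (subsets L)))
      ≡⟨ length-++ (filter (within? A) (subsets L)) ⟩
    length (filter (within? A) (subsets L)) + length (filter (within? A) (map (x ∷_) (subsets L)))
      ≡⟨ cong₂ _+_ (count-Within L A) (length-filter-map (within? A) (x ∷_) (subsets L)) ⟩
    indepCount L A + length (filter (within? A ∘ (x ∷_)) (subsets L))
      ≡⟨ cong (indepCount L A +_) extensions ⟩
    indepCount L A + guard (A x ∧ not (x ~ᵇ x)) (indepCount L (A ∖N x)) ∎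
    where
    open ≡-Reasoning
    extensions : length (filter (within? A ∘ (x ∷_)) (subsets L))
               ≡ guard (A x ∧ not (x ~ᵇ x)) (indepCount L (A ∖N x))
    extensions with A x ∧ not (x ~ᵇ x) in eq
    ... | true  = trans (cong length (filter-≐ (within? A ∘ (x ∷_)) (within? (A ∖N x))
                          ((proj₂ ∘ to Within-∷) , (λ w → from Within-∷ (subst T (sym eq) _ , w)))
                          (subsets L)))
                        (count-Within L (A ∖N x))
    ... | false = cong length (filter-none (within? A ∘ (x ∷_))
                    (All.universal (λ _ w → subst T eq (proj₁ (to Within-∷ w))) (subsets L)))

  count-Independent : ∀ (independent? : Decidable Independent) L →
                      length (filter independent? (subsets L)) ≡ indepCount L (λ _ → true)
  count-Independent independent? L = trans
    (cong length (filter-≐ independent? (within? (λ _ → true)) ((λ ind → ind , All.universal _ _) , proj₁) (subsets L)))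
    (count-Within L (λ _ → true))

  guard-+ : ∀ b k l → guard b (k + l) ≡ guard b k + guard b l
  guard-+ true  k l = refl
  guard-+ false k l = refl

  guard-∧ : ∀ a b k → guard a (guard b k) ≡ guard (a ∧ b) k
  guard-∧ true  b k = refl
  guard-∧ false b k = refl

  ≁ᵇ-sym : ∀ x y → x ≁ᵇ y ≡ y ≁ᵇ x
  ≁ᵇ-sym x y = ∧-comm (not (x ~ᵇ y)) (not (y ~ᵇ x))

  ∖N-comm : ∀ A x y v → ((A ∖N x) ∖N y) v ≡ ((A ∖N y) ∖N x) v
  ∖N-comm A x y v = solve 3 (λ a b c → (a ⊕ b) ⊕ c ⊜ (a ⊕ c) ⊕ b) refl (A v) (x ≁ᵇ v) (y ≁ᵇ v)

  indepCount-cong : ∀ L {A B} → (∀ v → A v ≡ B v) → indepCount L A ≡ indepCount L B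
  indepCount-cong []      A≗B = refl
  indepCount-cong (x ∷ L) {A} {B} A≗B =
    cong₂ _+_ (indepCount-cong L A≗B)
      (cong₂ (λ b k → guard (b ∧ not (x ~ᵇ x)) k) (A≗B x)
             (indepCount-cong L (λ v → cong (_∧ x ≁ᵇ v) (A≗B v))))

  indepCount-swap : ∀ x y L A → indepCount (x ∷ y ∷ L) A ≡ indepCount (y ∷ x ∷ L) A
  indepCount-swap x y L A = begin
    (c + guard αy cy) + guard αx (cx + guard βxy cxy)
      ≡⟨ cong ((c + guard αy cy) +_) (expand αx βxy cx cxy) ⟩
    (c + guard αy cy) + (guard αx cx + guard (αx ∧ βxy) cxy)
      ≡⟨ cong₂ (λ b k → (c + guard αy cy) + (guard αx cx + guard b k)) both (indepCount-cong L (∖N-comm A x y)) ⟩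
    (c + guard αy cy) + (guard αx cx + guard (αy ∧ βyx) cyx)
      ≡⟨ interchange c (guard αy cy) (guard αx cx) _ ⟩
    (c + guard αx cx) + (guard αy cy + guard (αy ∧ βyx) cyx)
      ≡⟨ cong ((c + guard αx cx) +_) (expand αy βyx cy cyx) ⟨
    (c + guard αx cx) + guard αy (cy + guard βyx cyx) ∎
    where
    open ≡-Reasoning
    c = indepCount L A
    αx = A x ∧ not (x ~ᵇ x)
    αy = A y ∧ not (y ~ᵇ y)
    cx = indepCount L (A ∖N x)
    cy = indepCount L (A ∖N y)
    βxy = (A ∖N x) y ∧ not (y ~ᵇ y)
    βyx = (A ∖N y) x ∧ not (x ~ᵇ x)
    cxy = indepCount L ((A ∖N x) ∖N y)
    cyx = indepCount L ((A ∖N y) ∖N x)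
    expand : ∀ a b k l → guard a (k + guard b l) ≡ guard a k + guard (a ∧ b) l
    expand a b k l = trans (guard-+ a k (guard b l)) (cong (guard a k +_) (guard-∧ a b l))
    both : αx ∧ βxy ≡ αy ∧ βyx
    both = trans (cong (λ b → αx ∧ ((A y ∧ b) ∧ not (y ~ᵇ y))) (≁ᵇ-sym x y))
      (solve 5 (λ a b c d e → (a ⊕ b) ⊕ ((c ⊕ e) ⊕ d) ⊜ (c ⊕ d) ⊕ ((a ⊕ e) ⊕ b)) refl
         (A x) (not (x ~ᵇ x)) (A y) (not (y ~ᵇ y)) (y ≁ᵇ x))
    interchange : ∀ a b c d → (a + b) + (c + d) ≡ (a + c) + (b + d)
    interchange = ℕ-Solver.solve-∀

  indepCount-∷-cong : ∀ x L L′ → (∀ A → indepCount L A ≡ indepCount L′ A) →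
                      ∀ A → indepCount (x ∷ L) A ≡ indepCount (x ∷ L′) A
  indepCount-∷-cong x L L′ L≈L′ A = cong₂ (λ k l → k + guard (A x ∧ not (x ~ᵇ x)) l) (L≈L′ A) (L≈L′ (A ∖N x))

  indepCount-↭ : ∀ {L L′} → L ↭ L′ → ∀ A → indepCount L A ≡ indepCount L′ A
  indepCount-↭ ↭.refl           A = refl
  indepCount-↭ (↭.prep {xs = L} {ys = L′} x p) A = indepCount-∷-cong x L L′ (indepCount-↭ p) A
  indepCount-↭ (↭.swap {xs = L} {ys = L′} x y p) A = trans
    (indepCount-∷-cong x (y ∷ L) (y ∷ L′) (indepCount-∷-cong y L L′ (indepCount-↭ p)) A)
    (indepCount-swap x y L′ A)
  indepCount-↭ (↭.trans p q)    A = trans (indepCount-↭ p A) (indepCount-↭ q A)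

  count : (V → Bool) → List V → ℕ
  count A xs = length (filterᵇ A xs)

  ≁ᵇ-true : ∀ {x v} → ¬ x ~ v → ¬ v ~ x → x ≁ᵇ v ≡ true
  ≁ᵇ-true ¬x~v ¬v~x = to T-≡ (from T-≁ᵇ (¬x~v , ¬v~x))

  count-∖N-Apart : ∀ A {x} L → Apart x L → count (A ∖N x) L ≡ count A L
  count-∖N-Apart A []      []                        = refl
  count-∖N-Apart A (v ∷ L) ((¬x~v , ¬v~x) ∷ apart)
    rewrite ≁ᵇ-true ¬x~v ¬v~x | ∧-identityʳ (A v) with A v
  ... | true  = cong suc (count-∖N-Apart A L apart)
  ... | false = count-∖N-Apart A L apart

  count-∖N-≤ : ∀ A x L → count A L ≤ count (A ∖N x) L + count (λ v → not (x ≁ᵇ v)) L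
  count-∖N-≤ A x []      = z≤n
  count-∖N-≤ A x (v ∷ L) with ih ← count-∖N-≤ A x L | A v | x ≁ᵇ v
  ... | true  | true  = s≤s ih
  ... | true  | false = ℕ.≤-trans (s≤s ih) (ℕ.≤-reflexive (sym (ℕ.+-suc _ _)))
  ... | false | true  = ih
  ... | false | false = ℕ.≤-trans ih (ℕ.+-monoʳ-≤ _ (ℕ.n≤1+n _))

  1≤indepCount : ∀ L A → 1 ≤ indepCount L A
  1≤indepCount []      A = s≤s z≤n
  1≤indepCount (x ∷ L) A = ℕ.≤-trans (1≤indepCount L A) (ℕ.m≤m+n _ _)

  guard-loopless : ∀ {x} k → ¬ x ~ x → guard (not (x ~ᵇ x)) k ≡ k
  guard-loopless {x} k ¬x~x rewrite to T-≡ (fromWitnessFalse {a? = x ~? x} ¬x~x) = refl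

  count-true : ∀ L → count (λ _ → true) L ≡ length L
  count-true L = cong length (filter-all (λ _ → T? true) (All.universal _ L))

  deg : V → List V → ℕ
  deg x = count (λ v → not (x ≁ᵇ v))

  adjacent-either : ∀ {x v} → T (not (x ≁ᵇ v)) → x ~ v ⊎ v ~ x
  adjacent-either {x} {v} t with x ~? v | v ~? x
  ... | yes x~v | _     = inj₁ x~v
  ... | no _    | yes v~x = inj₂ v~x
  ... | no _    | no _    = ⊥-elim t

  deg-≤ : ∀ {x Y Z} → Unique Y → (∀ {y} → y ∈ Y → x ~ y ⊎ y ~ x → y ∈ Z) → deg x Y ≤ length Z
  deg-≤ {x} {Y} unique nbrs⊆Z = Unique-⊆⇒length-≤ (Unique.filter⁺ _ unique)
    (λ y∈ → let y∈Y , t = ∈-filter⁻ (λ v → T? (not (x ≁ᵇ v))) y∈ in nbrs⊆Z y∈Y (adjacent-either t))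

  count-∖N-deg : ∀ {d} A x Y → deg x Y ≤ d → count A Y ≤ count (A ∖N x) Y + d
  count-∖N-deg A x Y deg≤d = ℕ.≤-trans (count-∖N-≤ A x Y) (ℕ.+-monoʳ-≤ _ deg≤d)

module Layering {V : Set} {_~_ : V → V → Set} (_~?_ : ∀ u v → Dec (u ~ v)) where
  open IndependentSets _~?_
  open import Data.Rational using (_+_; _*_; _≤_)
  open import Data.Rational.Properties
    using (≤-trans; ≤-reflexive; *-identityˡ; *-identityʳ; *-assoc; +-monoʳ-≤; +-mono-≤; module ≤-Reasoning)

  -- Each allowed vertex of the independent layer X multiplies the lower bound Φ by 1 + ν,
  -- as long as forbidding the neighbours of a vertex of X shrinks Φ by at most the factor ν.
  layer : ∀ (Φ : (V → Bool) → ℚ) {ν} R → 0ℚ ≤ ν → (∀ A → Φ A ≤ ι (indepCount R A)) →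
          ∀ X → Independent X → All (λ x → ∀ A → Φ A * ν ≤ Φ (A ∖N x)) X →
          ∀ A → Φ A * (1ℚ + ν) ^ℚ count A X ≤ ι (indepCount (X ++ R) A)
  layer Φ R 0≤ν base [] _ _ A = ≤-trans (≤-reflexive (*-identityʳ (Φ A))) (base A)
  layer Φ {ν} R 0≤ν base (x ∷ X) ind (loss ∷ losses) A
    with ¬x~x , apart , indX ← Independent-∷⁻ ind | A x in Ax
  ... | false = ≤-trans (layer Φ R 0≤ν base X indX losses A) (ι-mono-≤ (ℕ.m≤m+n (indepCount (X ++ R) A) _))
  ... | true  = begin
    Φ A * ((1ℚ + ν) * w)                    ≡⟨ split (Φ A) ν w ⟩
    Φ A * w + (Φ A * ν) * w                  ≤⟨ +-monoʳ-≤ (Φ A * w) (*-monoʳ-≤-≥0 (^ℚ-≥0 (count A X) 1+ν≥0) (loss A)) ⟩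
    Φ A * w + Φ (A ∖N x) * w                 ≡⟨ cong (λ k → Φ A * w + Φ (A ∖N x) * (1ℚ + ν) ^ℚ k)
                                                      (count-∖N-Apart A X apart) ⟨
    Φ A * w + Φ (A ∖N x) * (1ℚ + ν) ^ℚ count (A ∖N x) X
                                             ≤⟨ +-mono-≤ (layer Φ R 0≤ν base X indX losses A)
                                                            (layer Φ R 0≤ν base X indX losses (A ∖N x)) ⟩
    ι (indepCount (X ++ R) A) + ι (indepCount (X ++ R) (A ∖N x))
                                             ≡⟨ ι-+ (indepCount (X ++ R) A) (indepCount (X ++ R) (A ∖N x)) ⟨
    ι (indepCount (X ++ R) A ℕ.+ indepCount (X ++ R) (A ∖N x))
                                             ≡⟨ cong (λ k → ι (indepCount (X ++ R) A ℕ.+ k))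
                                                     (guard-loopless (indepCount (X ++ R) (A ∖N x)) ¬x~x) ⟨
    ι (indepCount (X ++ R) A ℕ.+ guard (not (x ~ᵇ x)) (indepCount (X ++ R) (A ∖N x))) ∎
    where
    open ≤-Reasoning
    w = (1ℚ + ν) ^ℚ count A X
    1+ν≥0 : 0ℚ ≤ 1ℚ + ν
    1+ν≥0 = ≤-trans 0≤1 (p≤p+q 0≤ν)
    split : ∀ φ ν w → φ * ((1ℚ + ν) * w) ≡ φ * w + (φ * ν) * w
    split = solve 3 (λ φ ν w → φ :* ((con 1ℚ :+ ν) :* w) := φ :* w :+ (φ :* ν) :* w) refl
      where open +-*-Solver

  module _ (Q P B R : List V) (d : ℕ) {μ ν : ℚ} (0≤μ : 0ℚ ≤ μ) (0≤ν : 0ℚ ≤ ν)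
           (2ᵈμ≤1 : ι 2 ^ℚ d * μ ≤ 1ℚ) (2ᵈ[1+μ]ᵈν≤1 : (ι 2 ^ℚ d * (1ℚ + μ) ^ℚ d) * ν ≤ 1ℚ)
           (indQ : Independent Q) (indP : Independent P) (indB : Independent B)
           (degP : All (λ x → deg x B ℕ.≤ d) P) (degQ : All (λ x → deg x B ℕ.≤ d × deg x P ℕ.≤ d) Q) where

    ΦP ΦQ : (V → Bool) → ℚ
    ΦP A = ι 2 ^ℚ count A B
    ΦQ A = ΦP A * (1ℚ + μ) ^ℚ count A P

    1≤2 : 1ℚ ≤ ι 2
    1≤2 = ι-mono-≤ {1} {2} (s≤s z≤n)

    1≤1+μ : 1ℚ ≤ 1ℚ + μ
    1≤1+μ = p≤p+q 0≤μ

    B-layer : ∀ A → ΦP A ≤ ι (indepCount (B ++ R) A)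
    B-layer A = ≤-trans (≤-reflexive (sym (*-identityˡ (ΦP A))))
      (layer (λ _ → 1ℚ) R 0≤1 (λ A → ι-mono-≤ (1≤indepCount R A)) B indB
        (All.universal (λ _ _ → ≤-reflexive (*-identityˡ 1ℚ)) B) A)

    P-loss : ∀ x → deg x B ℕ.≤ d → ∀ A → ΦP A * μ ≤ ΦP (A ∖N x)
    P-loss x deg≤d A = begin
      ΦP A * μ                         ≤⟨ *-monoʳ-≤-≥0 0≤μ (^ℚ-shift d 1≤2 (count-∖N-deg A x B deg≤d)) ⟩
      (ΦP (A ∖N x) * ι 2 ^ℚ d) * μ     ≡⟨ *-assoc (ΦP (A ∖N x)) _ μ ⟩
      ΦP (A ∖N x) * (ι 2 ^ℚ d * μ)     ≤⟨ *-monoˡ-≤-≥0 (^ℚ-≥0 (count (A ∖N x) B) (0≤ι 2)) 2ᵈμ≤1 ⟩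
      ΦP (A ∖N x) * 1ℚ                 ≡⟨ *-identityʳ _ ⟩
      ΦP (A ∖N x)                      ∎
      where open ≤-Reasoning

    P-layer : ∀ A → ΦQ A ≤ ι (indepCount (P ++ B ++ R) A)
    P-layer = layer ΦP (B ++ R) 0≤μ B-layer P indP (All.map (λ {x} deg≤d → P-loss x deg≤d) degP)

    Q-loss : ∀ x → deg x B ℕ.≤ d × deg x P ℕ.≤ d → ∀ A → ΦQ A * ν ≤ ΦQ (A ∖N x)
    Q-loss x (degB≤d , degP≤d) A = begin
      ΦQ A * ν
        ≤⟨ *-monoʳ-≤-≥0 0≤ν (*-mono-≤-≥0 (^ℚ-≥0 (count A B) (0≤ι 2)) (^ℚ-≥0 (count A P) 0≤1+μ)
             (^ℚ-shift d 1≤2 (count-∖N-deg A x B degB≤d)) (^ℚ-shift d 1≤1+μ (count-∖N-deg A x P degP≤d))) ⟩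
      ((ΦP (A ∖N x) * ι 2 ^ℚ d) * ((1ℚ + μ) ^ℚ count (A ∖N x) P * (1ℚ + μ) ^ℚ d)) * ν
        ≡⟨ regroup (ΦP (A ∖N x)) (ι 2 ^ℚ d) ((1ℚ + μ) ^ℚ count (A ∖N x) P) ((1ℚ + μ) ^ℚ d) ν ⟩
      ΦQ (A ∖N x) * ((ι 2 ^ℚ d * (1ℚ + μ) ^ℚ d) * ν)
        ≤⟨ *-monoˡ-≤-≥0 (*-≥0 (^ℚ-≥0 (count (A ∖N x) B) (0≤ι 2)) (^ℚ-≥0 (count (A ∖N x) P) 0≤1+μ))
             2ᵈ[1+μ]ᵈν≤1 ⟩
      ΦQ (A ∖N x) * 1ℚ
        ≡⟨ *-identityʳ _ ⟩
      ΦQ (A ∖N x) ∎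
      where
      open ≤-Reasoning
      0≤1+μ : 0ℚ ≤ 1ℚ + μ
      0≤1+μ = ≤-trans 0≤1 1≤1+μ
      regroup : ∀ a b c e f → ((a * b) * (c * e)) * f ≡ (a * c) * ((b * e) * f)
      regroup = solve 5 (λ a b c e f → ((a :* b) :* (c :* e)) :* f := (a :* c) :* ((b :* e) :* f)) refl
        where open +-*-Solver

    three-layers : ∀ A → ΦQ A * (1ℚ + ν) ^ℚ count A Q ≤ ι (indepCount (Q ++ P ++ B ++ R) A)
    three-layers = layer ΦQ (P ++ B ++ R) 0≤ν P-layer Q indQ (All.map (λ {x} degs → Q-loss x degs) degQ)

module Modular (m : ℕ) .{{_ : NonZero m}} where
  open import Data.Nat using (_+_; _∸_; _%_)

  %-absorbˡ : ∀ a b → (a % m + b) % m ≡ (a + b) % m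
  %-absorbˡ a b = begin
    (a % m + b) % m            ≡⟨ %-distribˡ-+ (a % m) b m ⟩
    (a % m % m + b % m) % m    ≡⟨ cong (λ x → (x + b % m) % m) (m%n%n≡m%n a m) ⟩
    (a % m + b % m) % m        ≡⟨ %-distribˡ-+ a b m ⟨
    (a + b) % m                ∎
    where open ≡-Reasoning

  %-absorbʳ : ∀ a b → (a + b % m) % m ≡ (a + b) % m
  %-absorbʳ a b = begin
    (a + b % m) % m  ≡⟨ cong (_% m) (ℕ.+-comm a (b % m)) ⟩
    (b % m + a) % m  ≡⟨ %-absorbˡ b a ⟩
    (b + a) % m      ≡⟨ cong (_% m) (ℕ.+-comm b a) ⟩
    (a + b) % m      ∎
    where open ≡-Reasoning

  %-cancelʳ-+ : ∀ a b c → (a + c) % m ≡ (b + c) % m → a % m ≡ b % m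
  %-cancelʳ-+ a b c eq = begin
    a % m                      ≡⟨ %-remove-+ʳ a m∣c+c′ ⟨
    (a + (c + c′)) % m         ≡⟨ cong (_% m) (ℕ.+-assoc a c c′) ⟨
    (a + c + c′) % m           ≡⟨ %-absorbˡ (a + c) c′ ⟨
    ((a + c) % m + c′) % m     ≡⟨ cong (λ x → (x + c′) % m) eq ⟩
    ((b + c) % m + c′) % m     ≡⟨ %-absorbˡ (b + c) c′ ⟩
    (b + c + c′) % m           ≡⟨ cong (_% m) (ℕ.+-assoc b c c′) ⟩
    (b + (c + c′)) % m         ≡⟨ %-remove-+ʳ b m∣c+c′ ⟩
    b % m                      ∎
    where
    open ≡-Reasoning
    c′ = m ∸ c % m
    m∣c+c′ : m ∣ c + c′
    m∣c+c′ = m%n≡0⇒n∣m (c + c′) m (begin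
      (c + c′) % m       ≡⟨ %-absorbˡ c c′ ⟨
      (c % m + c′) % m   ≡⟨ cong (_% m) (ℕ.m+[n∸m]≡n (ℕ.<⇒≤ (m%n<n c m))) ⟩
      m % m              ≡⟨ n%n≡0 m ⟩
      0                  ∎)

module _ where
  open import Data.Nat using (_+_; _*_; _%_)

  even⇒odd-suc : ∀ c → c % 2 ≡ 0 → (c + 1) % 2 ≡ 1
  even⇒odd-suc c c%2≡0 = trans (%-distribˡ-+ c 1 2) (cong (λ r → (r + 1) % 2) c%2≡0)

  even-double : ∀ j → (j + j) % 2 ≡ 0
  even-double j = trans (cong (_% 2) (double j)) (m*n%n≡0 j 2)
    where double : ∀ j → j + j ≡ j * 2
          double = ℕ-Solver.solve-∀

  odd-double : ∀ j → suc (j + j) % 2 ≡ 1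
  odd-double j = trans (cong (_% 2) (ℕ.+-comm 1 (j + j))) (even⇒odd-suc (j + j) (even-double j))

vec-ext : ∀ {A : Set} {k} (u v : Vec A k) → (∀ i → lookup u i ≡ lookup v i) → u ≡ v
vec-ext u v u≗v = trans (sym (Vec.tabulate∘lookup u)) (trans (Vec.tabulate-cong u≗v) (Vec.tabulate∘lookup v))

allVertices-Unique : ∀ m n → Unique (allVertices m n)
allVertices-Unique m zero    = All.[] ∷ []
allVertices-Unique m (suc n) = Unique.concat⁺
  (All.map⁺ (All.universal (λ x → Unique.map⁺ Vec.∷-injectiveʳ (allVertices-Unique m n)) (allFin m)))
  (AllPairs.map⁺ (AllPairs.map disjoint (Unique.allFin⁺ m)))
  where
  disjoint : ∀ {x y} → x ≢ y → ∀ {v} → ¬ (v ∈ map (x Vec.∷_) (allVertices m n) × v ∈ map (y Vec.∷_) (allVertices m n))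
  disjoint x≢y (v∈x∷ , v∈y∷) with ∈-map⁻ _ v∈x∷ | ∈-map⁻ _ v∈y∷
  ... | _ , _ , refl | _ , _ , x∷w≡y∷w′ = x≢y (Vec.∷-injectiveˡ x∷w≡y∷w′)

module Torus (m : ℕ) .{{_ : NonZero m}} where
  open Modular m
  open import Data.Nat using (_+_; _*_; _^_; _∸_; _%_; _/_; _≤_; _<_)
  open import Data.Vec using ([]; _∷_)

  coordSum : ∀ {k} → Vec (Fin m) k → ℕ
  coordSum v = Vec.sum (Vec.map toℕ v)

  level : ∀ {k} → Vec (Fin m) k → ℕ
  level v = coordSum v % m

  AgreeOff : ∀ {k} → Fin k → Vec (Fin m) k → Vec (Fin m) k → Set
  AgreeOff j u v = ∀ i → i ≢ j → lookup u i ≡ lookup v i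

  coordSum-AgreeOff : ∀ {k} (u v : Vec (Fin m) k) j → AgreeOff j u v →
               coordSum u + toℕ (lookup v j) ≡ coordSum v + toℕ (lookup u j)
  coordSum-AgreeOff (a ∷ u) (b ∷ v) Fin.zero agree
    rewrite vec-ext u v (λ i → agree (Fin.suc i) λ ()) = rearrange (toℕ a) (coordSum v) (toℕ b)
    where rearrange : ∀ a s b → a + s + b ≡ b + s + a
          rearrange = ℕ-Solver.solve-∀
  coordSum-AgreeOff (a ∷ u) (b ∷ v) (Fin.suc j) agree rewrite agree Fin.zero (λ ()) = begin
    toℕ b + coordSum u + toℕ (lookup v j)   ≡⟨ ℕ.+-assoc (toℕ b) (coordSum u) _ ⟩
    toℕ b + (coordSum u + toℕ (lookup v j)) ≡⟨ cong (toℕ b +_) (coordSum-AgreeOff u v j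
                                                 λ i i≢j → agree (Fin.suc i) (i≢j ∘ Fin.suc-injective)) ⟩
    toℕ b + (coordSum v + toℕ (lookup u j)) ≡⟨ ℕ.+-assoc (toℕ b) (coordSum v) _ ⟨
    toℕ b + coordSum v + toℕ (lookup u j)   ∎
    where open ≡-Reasoning

  level-step : ∀ {k} (u v : Vec (Fin m) k) j → AgreeOff j u v →
               toℕ (lookup u j) ≡ (toℕ (lookup v j) + 1) % m → level u ≡ (level v + 1) % m
  level-step u v j agree uⱼ≡vⱼ+1 = begin
    coordSum u % m           ≡⟨ %-cancelʳ-+ (coordSum u) (coordSum v + 1) vⱼ (begin
      (coordSum u + vⱼ) % m                   ≡⟨ cong (_% m) (coordSum-AgreeOff u v j agree) ⟩
      (coordSum v + toℕ (lookup u j)) % m     ≡⟨ cong (λ x → (coordSum v + x) % m) uⱼ≡vⱼ+1 ⟩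
      (coordSum v + (vⱼ + 1) % m) % m         ≡⟨ %-absorbʳ (coordSum v) (vⱼ + 1) ⟩
      (coordSum v + (vⱼ + 1)) % m             ≡⟨ cong (_% m) (shuffle (coordSum v) vⱼ) ⟩
      (coordSum v + 1 + vⱼ) % m               ∎) ⟩
    (coordSum v + 1) % m     ≡⟨ %-absorbˡ (coordSum v) 1 ⟨
    (coordSum v % m + 1) % m ∎
    where
    open ≡-Reasoning
    vⱼ = toℕ (lookup v j)
    shuffle : ∀ s x → s + (x + 1) ≡ s + 1 + x
    shuffle = ℕ-Solver.solve-∀

  sucₘ predₘ : Fin m → Fin m
  sucₘ a = fromℕ< (m%n<n (toℕ a + 1) m)
  predₘ a = fromℕ< (m%n<n (toℕ a + (m ∸ 1)) m)

  predₘ-inverse : ∀ a b → toℕ a ≡ (toℕ b + 1) % m → b ≡ predₘ a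
  predₘ-inverse a b a≡b+1 = Fin.toℕ-injective (sym (begin
    toℕ (predₘ a)                    ≡⟨ Fin.toℕ-fromℕ< _ ⟩
    (toℕ a + (m ∸ 1)) % m            ≡⟨ cong (λ x → (x + (m ∸ 1)) % m) a≡b+1 ⟩
    ((toℕ b + 1) % m + (m ∸ 1)) % m  ≡⟨ %-absorbˡ (toℕ b + 1) (m ∸ 1) ⟩
    (toℕ b + 1 + (m ∸ 1)) % m        ≡⟨ cong (_% m) (trans (ℕ.+-assoc (toℕ b) 1 (m ∸ 1)) (cong (toℕ b +_) 1+[m∸1]≡m)) ⟩
    (toℕ b + m) % m                  ≡⟨ [m+n]%n≡m%n (toℕ b) m ⟩
    toℕ b % m                        ≡⟨ m<n⇒m%n≡m (Fin.toℕ<n b) ⟩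
    toℕ b                            ∎))
    where
    open ≡-Reasoning
    1+[m∸1]≡m : 1 + (m ∸ 1) ≡ m
    1+[m∸1]≡m = ℕ.m+[n∸m]≡n (ℕ.>-nonZero⁻¹ m)

  sucₘ-inverse : ∀ a b → toℕ b ≡ (toℕ a + 1) % m → b ≡ sucₘ a
  sucₘ-inverse a b b≡a+1 = Fin.toℕ-injective (trans b≡a+1 (sym (Fin.toℕ-fromℕ< _)))

  raise lower : ∀ {n} → Vertex m n → Fin n → Vertex m n
  raise v j = v [ j ]≔ sucₘ (lookup v j)
  lower v j = v [ j ]≔ predₘ (lookup v j)

  AgreeOff⇒≡[]≔ : ∀ {n} (u v : Vertex m n) j {w} → AgreeOff j v u → lookup v j ≡ w → v ≡ u [ j ]≔ w
  AgreeOff⇒≡[]≔ u v j {w} agree vⱼ≡w = vec-ext v (u [ j ]≔ w) pointwise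
    where
    pointwise : ∀ i → lookup v i ≡ lookup (u [ j ]≔ w) i
    pointwise i with i Fin.≟ j
    ... | yes refl = trans vⱼ≡w (sym (Vec.lookup∘update i u w))
    ... | no i≢j   = trans (agree i i≢j) (sym (Vec.lookup∘update′ i≢j u w))

  adjacent-sym : ∀ {n} {u v : Vertex m n} → Adjacent m n u v → Adjacent m n v u
  adjacent-sym (j , u±v , agree) = j , Sum.swap u±v , λ i i≢j → sym (agree i i≢j)

  neighbour-cases : ∀ {n} {u v : Vertex m n} → Adjacent m n u v → Σ[ j ∈ Fin n ]
    ((level u ≡ (level v + 1) % m × v ≡ lower u j) ⊎ (level v ≡ (level u + 1) % m × v ≡ raise u j))
  neighbour-cases {u = u} {v} (j , inj₁ uⱼ≡vⱼ+1 , agree) = j , inj₁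
    (level-step u v j agree uⱼ≡vⱼ+1 ,
     AgreeOff⇒≡[]≔ u v j (λ i i≢j → sym (agree i i≢j)) (predₘ-inverse _ _ uⱼ≡vⱼ+1))
  neighbour-cases {u = u} {v} (j , inj₂ vⱼ≡uⱼ+1 , agree) = j , inj₂
    (level-step v u j (λ i i≢j → sym (agree i i≢j)) vⱼ≡uⱼ+1 ,
     AgreeOff⇒≡[]≔ u v j (λ i i≢j → sym (agree i i≢j)) (sucₘ-inverse _ _ vⱼ≡uⱼ+1))

  level≟ : ∀ {n} c (v : Vertex m n) → Dec (level v ≡ c)
  level≟ c v = level v ℕ.≟ c

  level-∷ : ∀ {n} x (w : Vertex m n) {c} → c < m → level (x Vec.∷ w) ≡ c ⇔ level w ≡ (c + (m ∸ toℕ x)) % m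
  level-∷ x w {c} c<m = mk⇔
    (λ lxw≡c → %-cancelʳ-+ (coordSum w) (c + (m ∸ toℕ x)) (toℕ x) (begin
      (coordSum w + toℕ x) % m             ≡⟨ cong (_% m) (ℕ.+-comm (coordSum w) (toℕ x)) ⟩
      level (x Vec.∷ w)                        ≡⟨ lxw≡c ⟩
      c                                    ≡⟨ c%m≡c ⟨
      c % m                                ≡⟨ [m+n]%n≡m%n c m ⟨
      (c + m) % m                          ≡⟨ cong (_% m) c+m≡c+[m∸x]+x ⟩
      (c + (m ∸ toℕ x) + toℕ x) % m        ∎))
    (λ lw≡c′ → begin
      (toℕ x + coordSum w) % m             ≡⟨ %-absorbʳ (toℕ x) (coordSum w) ⟨
      (toℕ x + level w) % m                ≡⟨ cong (λ l → (toℕ x + l) % m) lw≡c′ ⟩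
      (toℕ x + (c + (m ∸ toℕ x)) % m) % m  ≡⟨ %-absorbʳ (toℕ x) _ ⟩
      (toℕ x + (c + (m ∸ toℕ x))) % m      ≡⟨ cong (_% m) (trans (ℕ.+-comm (toℕ x) _) (sym c+m≡c+[m∸x]+x)) ⟩
      (c + m) % m                          ≡⟨ [m+n]%n≡m%n c m ⟩
      c % m                                ≡⟨ c%m≡c ⟩
      c                                    ∎)
    where
    open ≡-Reasoning
    c%m≡c : c % m ≡ c
    c%m≡c = m<n⇒m%n≡m c<m
    c+m≡c+[m∸x]+x : c + m ≡ c + (m ∸ toℕ x) + toℕ x
    c+m≡c+[m∸x]+x = trans (cong (c +_) (sym (ℕ.m∸n+n≡m (ℕ.<⇒≤ (Fin.toℕ<n x))))) (sym (ℕ.+-assoc c _ _))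

  length-filter-toℕ≡-allFin : ∀ {c} → c < m → length (filter (λ x → toℕ x ℕ.≟ c) (allFin m)) ≡ 1
  length-filter-toℕ≡-allFin {c} c<m = ℕ.≤-antisym
    (Unique-⊆⇒length-≤ {ys = fromℕ< c<m ∷ []} (Unique.filter⁺ (λ x → toℕ x ℕ.≟ c) (Unique.allFin⁺ m)) λ x∈ →
      here (Fin.toℕ-injective (trans (proj₂ (∈-filter⁻ (λ x → toℕ x ℕ.≟ c) {xs = allFin m} x∈))
                                     (sym (Fin.toℕ-fromℕ< c<m)))))
    (filter-some (λ x → toℕ x ℕ.≟ c)
      (Any.map {P = fromℕ< c<m ≡_} (λ eq → trans (cong toℕ (sym eq)) (Fin.toℕ-fromℕ< c<m)) (∈-allFin (fromℕ< c<m))))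

  level-count : ∀ n {c} → c < m → length (filter (level≟ c) (allVertices m (suc n))) ≡ m ^ n
  level-count zero {c} c<m = trans (cong (length ∘ filter (level≟ c)) (singletons (allFin m)))
    (trans (length-filter-map (level≟ c) (Vec._∷ Vec.[]) (allFin m))
    (trans (cong length (filter-≐ (λ x → level≟ c (x Vec.∷ Vec.[])) (λ x → toℕ x ℕ.≟ c)
             ((λ {x} e → trans (sym (level-singleton x)) e) , (λ {x} e → trans (level-singleton x) e)) (allFin m)))
           (length-filter-toℕ≡-allFin c<m)))
    where
    level-singleton : ∀ x → level (x Vec.∷ Vec.[]) ≡ toℕ x
    level-singleton x = trans (cong (_% m) (ℕ.+-identityʳ (toℕ x))) (m<n⇒m%n≡m (Fin.toℕ<n x))
    singletons : ∀ xs → concatMap (λ x → map (x Vec.∷_) (Vec.[] ∷ [])) xs ≡ map (Vec._∷ Vec.[]) xs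
    singletons []       = refl
    singletons (x ∷ xs) = cong ((x Vec.∷ Vec.[]) ∷_) (singletons xs)
  level-count (suc n) {c} c<m = trans
    (length-filter-concatMap (level≟ c) (λ x → map (x Vec.∷_) (allVertices m (suc n))) (allFin m) each)
    (cong (_* m ^ n) (length-tabulate {n = m} id))
    where
    each : ∀ x → length (filter (level≟ c) (map (x Vec.∷_) (allVertices m (suc n)))) ≡ m ^ n
    each x = begin
      length (filter (level≟ c) (map (x Vec.∷_) (allVertices m (suc n))))
        ≡⟨ length-filter-map (level≟ c) (x Vec.∷_) (allVertices m (suc n)) ⟩
      length (filter (level≟ c ∘ (x Vec.∷_)) (allVertices m (suc n)))
        ≡⟨ cong length (filter-≐ (level≟ c ∘ (x Vec.∷_)) (level≟ _)
             ((λ {w} → to (level-∷ x w c<m)) , (λ {w} → from (level-∷ x w c<m))) (allVertices m (suc n))) ⟩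
      length (filter (level≟ ((c + (m ∸ toℕ x)) % m)) (allVertices m (suc n)))
        ≡⟨ level-count n (m%n<n _ m) ⟩
      m ^ n ∎
      where open ≡-Reasoning

  #levels : ∀ {D : ℕ → Set} → Decidable D → ℕ → ℕ
  #levels D? t = length (filter D? (downFrom t))

  level-set-count : ∀ n {D : ℕ → Set} (D? : Decidable D) →
                    length (filter (D? ∘ level) (allVertices m (suc n))) ≡ #levels D? m * m ^ n
  level-set-count n {D} D? = trans
    (cong length (filter-≐ (D? ∘ level) (below? m) ((λ {v} d → d , m%n<n _ m) , proj₁) Vs))
    (below-count m ℕ.≤-refl)
    where
    Vs = allVertices m (suc n)
    below? : ∀ t → Decidable (λ (v : Vertex m (suc n)) → D (level v) × level v < t)
    below? t v = D? (level v) ×-dec level v ℕ.<? t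
    at? : ∀ t → Decidable (λ (v : Vertex m (suc n)) → D (level v) × level v ≡ t)
    at? t v = D? (level v) ×-dec level v ℕ.≟ t
    split : ∀ t xs → length (filter (below? (suc t)) xs) ≡ length (filter (below? t) xs) + length (filter (at? t) xs)
    split t = length-filter-⊎ (below? t) (at? t) (below? (suc t))
      (λ (d , l<1+t) → Data.Sum.map (d ,_) (d ,_) (ℕ.m≤n⇒m<n∨m≡n (ℕ.≤-pred l<1+t)))
      (λ (d , l<t) → d , ℕ.m<n⇒m<1+n l<t) (λ (d , l≡t) → d , s≤s (ℕ.≤-reflexive l≡t))
      (λ (_ , l<t) (_ , l≡t) → ℕ.<-irrefl l≡t l<t)
      where import Data.Sum
    at-level : ∀ t → D t → length (filter (at? t) Vs) ≡ length (filter (level≟ t) Vs)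
    at-level t Dt = cong length (filter-≐ (at? t) (level≟ t) (proj₂ , λ l≡t → subst D (sym l≡t) Dt , l≡t) Vs)
    below-count : ∀ t → t ≤ m → length (filter (below? t) Vs) ≡ #levels D? t * m ^ n
    below-count zero    _     = cong length (filter-none (below? 0) (All.universal (λ { _ (_ , ()) }) Vs))
    below-count (suc t) 1+t≤m with D? t
    ... | yes Dt = begin
      length (filter (below? (suc t)) Vs)                      ≡⟨ split t Vs ⟩
      length (filter (below? t) Vs) + length (filter (at? t) Vs)
        ≡⟨ cong₂ _+_ (below-count t (ℕ.<⇒≤ 1+t≤m)) (trans (at-level t Dt) (level-count n 1+t≤m)) ⟩
      #levels D? t * m ^ n + m ^ n                               ≡⟨ ℕ.+-comm _ (m ^ n) ⟩
      m ^ n + #levels D? t * m ^ n                               ∎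
      where open ≡-Reasoning
    ... | no ¬Dt = begin
      length (filter (below? (suc t)) Vs)                      ≡⟨ split t Vs ⟩
      length (filter (below? t) Vs) + length (filter (at? t) Vs)
        ≡⟨ cong₂ _+_ (below-count t (ℕ.<⇒≤ 1+t≤m))
             (cong length (filter-none (at? t) (All.universal (λ _ (d , l≡t) → ¬Dt (subst D l≡t d)) Vs))) ⟩
      #levels D? t * m ^ n + 0                                  ≡⟨ ℕ.+-identityʳ _ ⟩
      #levels D? t * m ^ n                                      ∎
      where open ≡-Reasoning

  IsB : ℕ → Set
  IsB c = c % 2 ≡ 0 × c + 3 ≤ m

  IsB? : Decidable IsB
  IsB? c = c % 2 ℕ.≟ 0 ×-dec c + 3 ℕ.≤? m

  #B-levels-below : ∀ j → j + j + 1 ≤ m → #levels IsB? (j + j) ≡ j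
  #B-levels-below zero    _      = refl
  #B-levels-below (suc j) 2j+3≤m rewrite ℕ.+-suc j j = begin
    length (filter IsB? (suc (j + j) ∷ j + j ∷ downFrom (j + j)))
      ≡⟨ cong length (filter-reject IsB? {x = suc (j + j)} {xs = j + j ∷ downFrom (j + j)}
           (λ (odd≡0 , _) → 1≢0 (trans (sym (odd-double j)) odd≡0))) ⟩
    length (filter IsB? (j + j ∷ downFrom (j + j)))
      ≡⟨ cong length (filter-accept IsB? {x = j + j} {xs = downFrom (j + j)}
           (even-double j , subst (_≤ m) (shuffle j) 2j+3≤m)) ⟩
    suc (#levels IsB? (j + j))
      ≡⟨ cong suc (#B-levels-below j (ℕ.≤-trans (ℕ.m≤n+m (j + j + 1) 2) 2j+3≤m)) ⟩
    suc j ∎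
    where
    open ≡-Reasoning
    1≢0 : 1 ≢ 0
    1≢0 ()
    shuffle : ∀ j → suc (suc (j + j)) + 1 ≡ j + j + 3
    shuffle = ℕ-Solver.solve-∀

  #B-levels : m % 2 ≡ 1 → #levels IsB? m ≡ m / 2
  #B-levels m-odd = trans (cong (#levels IsB?) m≡1+k+k) top-excluded
    where
    k = m / 2
    m≡1+k+k : m ≡ suc (k + k)
    m≡1+k+k = trans (m≡m%n+[m/n]*n m 2) (cong₂ _+_ m-odd (trans (ℕ.*-comm k 2) (cong (k +_) (ℕ.+-identityʳ k))))
    m≡k+k+1 : m ≡ k + k + 1
    m≡k+k+1 = trans m≡1+k+k (ℕ.+-comm 1 (k + k))
    top-excluded : #levels IsB? (suc (k + k)) ≡ k
    top-excluded = trans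
      (cong length (filter-reject IsB? {x = k + k} {xs = downFrom (k + k)} λ (_ , 2k+3≤m) →
        ℕ.<⇒≱ (ℕ.+-monoʳ-< (k + k) (s≤s (s≤s z≤n))) (subst (k + k + 3 ≤_) m≡k+k+1 2k+3≤m)))
      (#B-levels-below k (ℕ.≤-reflexive (sym m≡k+k+1)))

-- The layers B, P and Q of the torus

module _ where
  open import Data.Nat using (_+_; _∸_; _%_; _≤_)

  m∸2+1≡m∸1 : ∀ {m} → 2 ≤ m → m ∸ 2 + 1 ≡ m ∸ 1
  m∸2+1≡m∸1 {suc (suc k)} (s≤s (s≤s _)) = ℕ.+-comm k 1

  m∸1≢0 : ∀ {m} → 2 ≤ m → m ∸ 1 ≢ 0
  m∸1≢0 {suc (suc k)} (s≤s (s≤s _)) ()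

  m∸2≢0 : ∀ {m} → 3 ≤ m → m ∸ 2 ≢ 0
  m∸2≢0 {suc (suc (suc k))} (s≤s (s≤s (s≤s _))) ()

  m∸2≢m∸1 : ∀ {m} → 2 ≤ m → m ∸ 2 ≢ m ∸ 1
  m∸2≢m∸1 {suc (suc k)} (s≤s (s≤s _)) = ℕ.1+n≢n ∘ sym

  [m∸1+1]%m≡0 : ∀ m .{{_ : NonZero m}} → (m ∸ 1 + 1) % m ≡ 0
  [m∸1+1]%m≡0 (suc k) = trans (cong (_% suc k) (ℕ.+-comm k 1)) (n%n≡0 (suc k))

  [m∸2+1]%m≡m∸1 : ∀ m .{{_ : NonZero m}} → 2 ≤ m → (m ∸ 2 + 1) % m ≡ m ∸ 1
  [m∸2+1]%m≡m∸1 m@(suc k) 2≤m = trans (cong (_% m) (m∸2+1≡m∸1 2≤m)) (m<n⇒m%n≡m (ℕ.n<1+n k))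

  below-top : ∀ {m c j} → j ≤ 1 → c + j ≡ m ∸ 1 → c + 3 ≤ m → ⊥
  below-top {zero}  {c} _ _ c+3≤0 = ℕ.<⇒≱ (s≤s z≤n) (ℕ.≤-trans (ℕ.m≤n+m 3 c) c+3≤0)
  below-top {suc t} {c} {j} j≤1 refl c+3≤m =
    ℕ.<⇒≱ (s≤s j≤1) (ℕ.+-cancelˡ-≤ c 2 j (ℕ.≤-pred (subst (_≤ suc (c + j)) (ℕ.+-suc c 2) c+3≤m)))

module TorusLayers (m : ℕ) .{{_ : NonZero m}} (3≤m : 3 ℕ.≤ m) (n : ℕ) where
  open import Data.Nat using (_+_; _∸_; _%_; _≤_)
  open Torus m
  open IndependentSets (adjacent? m n)

  Sparse : Pred ℕ _ → Set
  Sparse S = ∀ {c c′} → S c → S c′ → c′ ≢ (c + 1) % m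

  Sparse⇒Independent : ∀ {S} → Sparse S → ∀ {L} → All (S ∘ level) L → Independent L
  Sparse⇒Independent {S} sparse {L} S[L] = All.map (λ {u} Su → All.map (λ {v} Sv → nonadjacent {u} {v} Su Sv) S[L]) S[L]
    where
    nonadjacent : ∀ {u v} → S (level u) → S (level v) → ¬ Adjacent m n u v
    nonadjacent {u} {v} Su Sv u~v with neighbour-cases {u = u} {v} u~v
    ... | _ , inj₁ (lu≡lv+1 , _) = sparse Sv Su lu≡lv+1
    ... | _ , inj₂ (lv≡lu+1 , _) = sparse Su Sv lv≡lu+1

  length-allFin-map : ∀ (f : Fin n → Vertex m n) → length (map f (allFin n)) ≡ n
  length-allFin-map f = trans (length-map f (allFin n)) (length-tabulate (λ j → j))

  deg-lower : ∀ {x Y} → Unique Y → (∀ {y} → y ∈ Y → level y ≢ (level x + 1) % m) → deg x Y ≤ n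
  deg-lower {x} {Y} unique not-above = subst (deg x Y ≤_) (length-allFin-map (lower x)) (deg-≤ {x} unique below)
    where
    below : ∀ {y} → y ∈ Y → Adjacent m n x y ⊎ Adjacent m n y x → y ∈ map (lower x) (allFin n)
    below {y} y∈Y x~y⊎y~x with neighbour-cases {u = x} {y} ([ (λ a → a) , adjacent-sym {u = y} {x} ]′ x~y⊎y~x)
    ... | j , inj₁ (_ , y≡lower) = subst (_∈ map (lower x) (allFin n)) (sym y≡lower) (∈-map⁺ (lower x) (∈-allFin j))
    ... | _ , inj₂ (ly≡lx+1 , _) = ⊥-elim (not-above y∈Y ly≡lx+1)

  deg-raise : ∀ {x Y} → Unique Y → (∀ {y} → y ∈ Y → level x ≢ (level y + 1) % m) → deg x Y ≤ n
  deg-raise {x} {Y} unique not-below = subst (deg x Y ≤_) (length-allFin-map (raise x)) (deg-≤ {x} unique above)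
    where
    above : ∀ {y} → y ∈ Y → Adjacent m n x y ⊎ Adjacent m n y x → y ∈ map (raise x) (allFin n)
    above {y} y∈Y x~y⊎y~x with neighbour-cases {u = x} {y} ([ (λ a → a) , adjacent-sym {u = y} {x} ]′ x~y⊎y~x)
    ... | _ , inj₁ (lx≡ly+1 , _) = ⊥-elim (not-below y∈Y lx≡ly+1)
    ... | j , inj₂ (_ , y≡raise) = subst (_∈ map (raise x) (allFin n)) (sym y≡raise) (∈-map⁺ (raise x) (∈-allFin j))

  2≤m : 2 ≤ m
  2≤m = ℕ.≤-trans (s≤s (s≤s z≤n)) 3≤m

  top-sparse : Sparse (_≡ m ∸ 1)
  top-sparse refl refl eq = m∸1≢0 2≤m (trans eq ([m∸1+1]%m≡0 m))

  next-sparse : Sparse (_≡ m ∸ 2)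
  next-sparse refl refl eq = m∸2≢m∸1 2≤m (trans eq ([m∸2+1]%m≡m∸1 m 2≤m))

  [c+1]%m≡c+1 : ∀ {c} → c + 3 ≤ m → (c + 1) % m ≡ c + 1
  [c+1]%m≡c+1 {c} c+3≤m =
    m<n⇒m%n≡m (ℕ.≤-trans (ℕ.≤-reflexive (sym (ℕ.+-suc c 1))) (ℕ.≤-trans (ℕ.+-monoʳ-≤ c (ℕ.n≤1+n 2)) c+3≤m))

  B-sparse : Sparse IsB
  B-sparse {c} (c%2≡0 , c+3≤m) (c′%2≡0 , _) eq with trans eq ([c+1]%m≡c+1 c+3≤m)
  ... | refl with () ← trans (sym (even⇒odd-suc c c%2≡0)) c′%2≡0

  Vs : List (Vertex m n)
  Vs = allVertices m n

  Qs Ps Bs : List (Vertex m n)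
  Qs = filter (level≟ (m ∸ 1)) Vs
  Ps = filter (level≟ (m ∸ 2)) Vs
  Bs = filter (IsB? ∘ level) Vs

  Vs-Unique : Unique Vs
  Vs-Unique = allVertices-Unique m n

  Qs-independent : Independent Qs
  Qs-independent = Sparse⇒Independent top-sparse (All.all-filter (level≟ (m ∸ 1)) Vs)

  Ps-independent : Independent Ps
  Ps-independent = Sparse⇒Independent next-sparse (All.all-filter (level≟ (m ∸ 2)) Vs)

  Bs-independent : Independent Bs
  Bs-independent = Sparse⇒Independent B-sparse (All.all-filter (IsB? ∘ level) Vs)

  IsB-level : ∀ {y} → y ∈ Bs → IsB (level y)
  IsB-level y∈Bs = proj₂ (∈-filter⁻ (IsB? ∘ level) {xs = Vs} y∈Bs)

  deg-P-B : All (λ x → deg x Bs ≤ n) Ps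
  deg-P-B = All.map (λ {x} lx≡m∸2 → deg-lower {x} (Unique.filter⁺ (IsB? ∘ level) Vs-Unique) λ {y} y∈Bs ly≡lx+1 →
      below-top z≤n (trans (ℕ.+-identityʳ (level y))
        (trans ly≡lx+1 (trans (cong (λ c → (c + 1) % m) lx≡m∸2) ([m∸2+1]%m≡m∸1 m 2≤m))))
      (proj₂ (IsB-level y∈Bs)))
    (All.all-filter (level≟ (m ∸ 2)) Vs)

  deg-Q : All (λ x → deg x Bs ≤ n × deg x Ps ≤ n) Qs
  deg-Q = All.map (λ {x} lx≡m∸1 →
      deg-raise {x} (Unique.filter⁺ (IsB? ∘ level) Vs-Unique) (λ {y} y∈Bs lx≡ly+1 → let _ , ly+3≤m = IsB-level y∈Bs in
        below-top ℕ.≤-refl (trans (sym ([c+1]%m≡c+1 ly+3≤m)) (trans (sym lx≡ly+1) lx≡m∸1)) ly+3≤m) ,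
      deg-lower {x} (Unique.filter⁺ (level≟ (m ∸ 2)) Vs-Unique) (λ {y} y∈Ps ly≡lx+1 →
        m∸2≢0 3≤m (trans (sym (proj₂ (∈-filter⁻ (level≟ (m ∸ 2)) {xs = Vs} y∈Ps)))
          (trans ly≡lx+1 (trans (cong (λ c → (c + 1) % m) lx≡m∸1) ([m∸1+1]%m≡0 m))))))
    (All.all-filter (level≟ (m ∸ 1)) Vs)

  Q⇒¬P : ∀ {v : Vertex m n} → level v ≡ m ∸ 1 → level v ≢ m ∸ 2
  Q⇒¬P lv≡m∸1 lv≡m∸2 = m∸2≢m∸1 2≤m (trans (sym lv≡m∸2) lv≡m∸1)

  Q⇒¬B : ∀ {v : Vertex m n} → level v ≡ m ∸ 1 → ¬ IsB (level v)
  Q⇒¬B {v} lv≡m∸1 (_ , lv+3≤m) = below-top z≤n (trans (ℕ.+-identityʳ (level v)) lv≡m∸1) lv+3≤m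

  P⇒¬B : ∀ {v : Vertex m n} → level v ≡ m ∸ 2 → ¬ IsB (level v)
  P⇒¬B lv≡m∸2 (_ , lv+3≤m) = below-top ℕ.≤-refl (trans (cong (_+ 1) lv≡m∸2) (m∸2+1≡m∸1 2≤m)) lv+3≤m

  Rs : List (Vertex m n)
  Rs = filter (none? (level≟ (m ∸ 1)) (level≟ (m ∸ 2)) (IsB? ∘ level)
                     (λ {v} → Q⇒¬P {v}) (λ {v} → Q⇒¬B {v}) (λ {v} → P⇒¬B {v})) Vs

  Vs↭QPBR : Vs ↭ Qs ++ Ps ++ Bs ++ Rs
  Vs↭QPBR = ↭-partition (level≟ (m ∸ 1)) (level≟ (m ∸ 2)) (IsB? ∘ level)
                        (λ {v} → Q⇒¬P {v}) (λ {v} → Q⇒¬B {v}) (λ {v} → P⇒¬B {v}) Vs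

-- The exponential series against the negative binomial series

module _ where
  open import Data.Rational using (_+_; _*_; _-_; _≤_)
  open import Data.Rational.Properties

  risingFactorial : ℕ → ℕ → ℕ
  risingFactorial L zero    = 1
  risingFactorial L (suc k) = risingFactorial L k ℕ.* (L ℕ.+ k)

  ^≤risingFactorial : ∀ L k → L ℕ.^ k ℕ.≤ risingFactorial L k
  ^≤risingFactorial L zero    = ℕ.≤-refl
  ^≤risingFactorial L (suc k) =
    ℕ.≤-trans (ℕ.≤-reflexive (ℕ.*-comm L (L ℕ.^ k))) (ℕ.*-mono-≤ (^≤risingFactorial L k) (ℕ.m≤m+n L k))

  risingFactorial-0 : ∀ k → risingFactorial 0 (suc k) ≡ 0
  risingFactorial-0 zero    = refl
  risingFactorial-0 (suc k) = cong (ℕ._* suc k) (risingFactorial-0 k)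

  *-risingFactorial-suc : ∀ L k → L ℕ.* risingFactorial (suc L) k ≡ risingFactorial L k ℕ.* (L ℕ.+ k)
  *-risingFactorial-suc L zero    = solve L
    where solve : ∀ L → L ℕ.* 1 ≡ 1 ℕ.* (L ℕ.+ 0)
          solve = ℕ-Solver.solve-∀
  *-risingFactorial-suc L (suc k) = begin
    L ℕ.* (risingFactorial (suc L) k ℕ.* (suc L ℕ.+ k))   ≡⟨ ℕ.*-assoc L _ _ ⟨
    L ℕ.* risingFactorial (suc L) k ℕ.* (suc L ℕ.+ k)     ≡⟨ cong₂ ℕ._*_ (*-risingFactorial-suc L k) (sym (ℕ.+-suc L k)) ⟩
    risingFactorial L k ℕ.* (L ℕ.+ k) ℕ.* (L ℕ.+ suc k)   ∎
    where open ≡-Reasoning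

  risingFactorial-suc : ∀ L k → risingFactorial (suc L) (suc k) ≡ risingFactorial L (suc k) ℕ.+ suc k ℕ.* risingFactorial (suc L) k
  risingFactorial-suc L k = begin
    risingFactorial (suc L) k ℕ.* (suc L ℕ.+ k)                     ≡⟨ split (risingFactorial (suc L) k) L k ⟩
    L ℕ.* risingFactorial (suc L) k ℕ.+ suc k ℕ.* risingFactorial (suc L) k    ≡⟨ cong (ℕ._+ suc k ℕ.* risingFactorial (suc L) k) (*-risingFactorial-suc L k) ⟩
    risingFactorial L k ℕ.* (L ℕ.+ k) ℕ.+ suc k ℕ.* risingFactorial (suc L) k  ∎
    where
    open ≡-Reasoning
    split : ∀ x L k → x ℕ.* (suc L ℕ.+ k) ≡ L ℕ.* x ℕ.+ suc k ℕ.* x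
    split = ℕ-Solver.solve-∀

  -- partial sums of the series (1 - r)⁻ᴸ = Σₖ L (L + 1) ⋯ (L + k - 1) rᵏ / k!
  negBin : ℚ → ℕ → ℕ → ℚ
  negBin r L zero    = 0ℚ
  negBin r L (suc K) = negBin r L K + ι (risingFactorial L K) * (r ^ℚ K * fact⁻¹ K)

  negBin-term-≥0 : ∀ {r} L K → 0ℚ ≤ r → 0ℚ ≤ ι (risingFactorial L K) * (r ^ℚ K * fact⁻¹ K)
  negBin-term-≥0 L K 0≤r = *-≥0 (0≤ι (risingFactorial L K)) (*-≥0 (^ℚ-≥0 K 0≤r) (0≤fact⁻¹ K))

  negBin-mono : ∀ {r} L K → 0ℚ ≤ r → negBin r L K ≤ negBin r L (suc K)
  negBin-mono {r} L K 0≤r = ≤-trans (≤-reflexive (sym (+-identityʳ (negBin r L K))))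
                                    (+-monoʳ-≤ (negBin r L K) (negBin-term-≥0 L K 0≤r))

  expPartial≤negBin : ∀ {r} L K → 0ℚ ≤ r → expPartial K (ι L * r) ≤ negBin r L K
  expPartial≤negBin L zero    0≤r = ≤-refl
  expPartial≤negBin {r} L (suc K) 0≤r = +-mono-≤ (expPartial≤negBin L K 0≤r) (begin
    (ι L * r) ^ℚ K * fact⁻¹ K             ≡⟨ cong (_* fact⁻¹ K) (trans (*-^ℚ (ι L) r K) (cong (_* r ^ℚ K) (sym (ι-^ L K)))) ⟩
    (ι (L ℕ.^ K) * r ^ℚ K) * fact⁻¹ K     ≡⟨ *-assoc (ι (L ℕ.^ K)) _ _ ⟩
    ι (L ℕ.^ K) * (r ^ℚ K * fact⁻¹ K)     ≤⟨ *-monoʳ-≤-≥0 (*-≥0 (^ℚ-≥0 K 0≤r) (0≤fact⁻¹ K)) (ι-mono-≤ (^≤risingFactorial L K)) ⟩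
    ι (risingFactorial L K) * (r ^ℚ K * fact⁻¹ K)    ∎)
    where open ≤-Reasoning

  negBin-0 : ∀ r K → negBin r 0 (suc K) ≡ 1ℚ
  negBin-0 r zero    = refl
  negBin-0 r (suc K) = begin
    negBin r 0 (suc K) + ι (risingFactorial 0 (suc K)) * (r ^ℚ suc K * fact⁻¹ (suc K))
      ≡⟨ cong₂ (λ a k → a + ι k * (r ^ℚ suc K * fact⁻¹ (suc K))) (negBin-0 r K) (risingFactorial-0 K) ⟩
    1ℚ + 0ℚ * (r ^ℚ suc K * fact⁻¹ (suc K))
      ≡⟨ cong (1ℚ +_) (*-zeroˡ (r ^ℚ suc K * fact⁻¹ (suc K))) ⟩
    1ℚ ∎
    where open ≡-Reasoning

  negBin-suc : ∀ r L K → negBin r (suc L) (suc K) ≡ negBin r L (suc K) + r * negBin r (suc L) K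
  negBin-suc r L zero    = sym (trans (cong (negBin r L 1 +_) (*-zeroʳ r)) (+-identityʳ (negBin r L 1)))
  negBin-suc r L (suc K) = begin
    negBin r (suc L) (suc K) + ι (risingFactorial (suc L) (suc K)) * ((r * p) * f′)
      ≡⟨ cong₂ (λ a b → a + b * ((r * p) * f′)) (negBin-suc r L K)
           (trans (cong ι (risingFactorial-suc L K))
             (trans (ι-+ (risingFactorial L (suc K)) (suc K ℕ.* risingFactorial (suc L) K))
                    (cong (x +_) (ι-* (suc K) (risingFactorial (suc L) K))))) ⟩
    (a + r * b) + (x + c * y) * ((r * p) * f′)
      ≡⟨ regroup a b x y c r p f′ ⟩
    (a + x * ((r * p) * f′)) + r * (b + y * (p * (c * f′)))
      ≡⟨ cong (λ f → (a + x * ((r * p) * f′)) + r * (b + y * (p * f))) (fact⁻¹-suc K) ⟩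
    (a + x * ((r * p) * f′)) + r * (b + y * (p * fact⁻¹ K)) ∎
    where
    open ≡-Reasoning
    open +-*-Solver
    a = negBin r L (suc K)
    b = negBin r (suc L) K
    x = ι (risingFactorial L (suc K))
    y = ι (risingFactorial (suc L) K)
    c = ι (suc K)
    p = r ^ℚ K
    f′ = fact⁻¹ (suc K)
    regroup : ∀ a b x y c r p f → (a + r * b) + (x + c * y) * ((r * p) * f) ≡ (a + x * ((r * p) * f)) + r * (b + y * (p * (c * f)))
    regroup = solve 8 (λ a b x y c r p f → (a :+ r :* b) :+ (x :+ c :* y) :* ((r :* p) :* f)
                                        := (a :+ x :* ((r :* p) :* f)) :+ r :* (b :+ y :* (p :* (c :* f)))) refl

  [1-r]*negBin-suc≤negBin : ∀ {r} L K → 0ℚ ≤ r → (1ℚ - r) * negBin r (suc L) K ≤ negBin r L K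
  [1-r]*negBin-suc≤negBin {r} L zero    0≤r = ≤-reflexive (*-zeroʳ (1ℚ - r))
  [1-r]*negBin-suc≤negBin {r} L (suc K) 0≤r = begin
    (1ℚ - r) * X            ≡⟨ expand X r ⟩
    X - r * X               ≤⟨ +-monoˡ-≤ (ℚ.- (r * X)) X≤A+rX ⟩
    (A + r * X) - r * X     ≡⟨ cancel A r X ⟩
    A                       ∎
    where
    open ≤-Reasoning
    open +-*-Solver
    X = negBin r (suc L) (suc K)
    A = negBin r L (suc K)
    X≤A+rX : X ≤ A + r * X
    X≤A+rX = ≤-trans (≤-reflexive (negBin-suc r L K)) (+-monoʳ-≤ A (*-monoˡ-≤-≥0 0≤r (negBin-mono (suc L) K 0≤r)))
    expand : ∀ X r → (1ℚ - r) * X ≡ X - r * X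
    expand = solve 2 (λ X r → (con 1ℚ :- r) :* X := X :- r :* X) refl
    cancel : ∀ A r X → (A + r * X) - r * X ≡ A
    cancel = solve 3 (λ A r X → (A :+ r :* X) :- r :* X := A) refl

  [1-r]^L*negBin≤1 : ∀ {r} L K → 0ℚ ≤ r → r ≤ 1ℚ → (1ℚ - r) ^ℚ L * negBin r L K ≤ 1ℚ
  [1-r]^L*negBin≤1 {r} zero zero    0≤r r≤1 = ≤-trans (≤-reflexive (*-zeroʳ 1ℚ)) 0≤1
  [1-r]^L*negBin≤1 {r} zero (suc K) 0≤r r≤1 = ≤-reflexive (trans (*-identityˡ _) (negBin-0 r K))
  [1-r]^L*negBin≤1 {r} (suc L) K 0≤r r≤1 = begin
    ((1ℚ - r) * (1ℚ - r) ^ℚ L) * negBin r (suc L) K  ≡⟨ *-assoc (1ℚ - r) _ _ ⟩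
    (1ℚ - r) * ((1ℚ - r) ^ℚ L * negBin r (suc L) K)  ≡⟨ *-comm (1ℚ - r) _ ⟩
    ((1ℚ - r) ^ℚ L * negBin r (suc L) K) * (1ℚ - r)  ≡⟨ *-assoc ((1ℚ - r) ^ℚ L) _ _ ⟩
    (1ℚ - r) ^ℚ L * (negBin r (suc L) K * (1ℚ - r))  ≡⟨ cong ((1ℚ - r) ^ℚ L *_) (*-comm _ (1ℚ - r)) ⟩
    (1ℚ - r) ^ℚ L * ((1ℚ - r) * negBin r (suc L) K)  ≤⟨ *-monoˡ-≤-≥0 (^ℚ-≥0 L 0≤1-r) ([1-r]*negBin-suc≤negBin L K 0≤r) ⟩
    (1ℚ - r) ^ℚ L * negBin r L K                     ≤⟨ [1-r]^L*negBin≤1 L K 0≤r r≤1 ⟩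
    1ℚ                                               ∎
    where
    open ≤-Reasoning
    0≤1-r : 0ℚ ≤ 1ℚ - r
    0≤1-r = p≤q⇒0≤q-p r≤1

  expPartial*[1-r]^L≤1 : ∀ {r} L K → 0ℚ ≤ r → r ≤ 1ℚ → expPartial K (ι L * r) * (1ℚ - r) ^ℚ L ≤ 1ℚ
  expPartial*[1-r]^L≤1 {r} L K 0≤r r≤1 = begin
    expPartial K (ι L * r) * (1ℚ - r) ^ℚ L  ≡⟨ *-comm _ ((1ℚ - r) ^ℚ L) ⟩
    (1ℚ - r) ^ℚ L * expPartial K (ι L * r)  ≤⟨ *-monoˡ-≤-≥0 (^ℚ-≥0 L 0≤1-r) (expPartial≤negBin L K 0≤r) ⟩
    (1ℚ - r) ^ℚ L * negBin r L K            ≤⟨ [1-r]^L*negBin≤1 L K 0≤r r≤1 ⟩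
    1ℚ                                      ∎
    where
    open ≤-Reasoning
    0≤1-r : 0ℚ ≤ 1ℚ - r
    0≤1-r = p≤q⇒0≤q-p r≤1

  [1+μ]^j≤1+2jμ : ∀ {μ} j → 0ℚ ≤ μ → (ι j + ι j) * μ ≤ 1ℚ → (1ℚ + μ) ^ℚ j ≤ 1ℚ + (ι j + ι j) * μ
  [1+μ]^j≤1+2jμ {μ} zero    0≤μ _      = p≤p+q (*-≥0 ≤-refl 0≤μ)
  [1+μ]^j≤1+2jμ {μ} (suc j) 0≤μ 2jμ≤1 = begin
    (1ℚ + μ) * (1ℚ + μ) ^ℚ j         ≤⟨ *-monoˡ-≤-≥0 (≤-trans 0≤1 (p≤p+q 0≤μ)) ([1+μ]^j≤1+2jμ j 0≤μ 2tμ≤1) ⟩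
    (1ℚ + μ) * (1ℚ + (t + t) * μ)    ≤⟨ p≤p+q (*-≥0 0≤μ (p≤q⇒0≤q-p 2tμ≤1)) ⟩
    (1ℚ + μ) * (1ℚ + (t + t) * μ) + μ * (1ℚ - (t + t) * μ)  ≡⟨ expand t μ ⟩
    1ℚ + ((1ℚ + t) + (1ℚ + t)) * μ   ≡⟨ cong (λ s → 1ℚ + (s + s) * μ) (ι-suc j) ⟨
    1ℚ + (ι (suc j) + ι (suc j)) * μ ∎
    where
    open ≤-Reasoning
    open +-*-Solver
    t = ι j
    2tμ≤1 : (t + t) * μ ≤ 1ℚ
    2tμ≤1 = ≤-trans (*-monoʳ-≤-≥0 0≤μ (+-mono-≤ (ι-mono-≤ (ℕ.n≤1+n j)) (ι-mono-≤ (ℕ.n≤1+n j)))) 2jμ≤1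
    expand : ∀ t μ → (1ℚ + μ) * (1ℚ + (t + t) * μ) + μ * (1ℚ - (t + t) * μ) ≡ 1ℚ + ((1ℚ + t) + (1ℚ + t)) * μ
    expand = solve 2 (λ t μ → (con 1ℚ :+ μ) :* (con 1ℚ :+ (t :+ t) :* μ) :+ μ :* (con 1ℚ :- (t :+ t) :* μ)
                              := con 1ℚ :+ ((con 1ℚ :+ t) :+ (con 1ℚ :+ t)) :* μ) refl

  expPartial-≥0 : ∀ {x} K → 0ℚ ≤ x → 0ℚ ≤ expPartial K x
  expPartial-≥0 zero    0≤x = ≤-refl
  expPartial-≥0 (suc K) 0≤x = ≤-trans (expPartial-≥0 K 0≤x) (p≤p+q (*-≥0 (^ℚ-≥0 K 0≤x) (0≤fact⁻¹ K)))

  expPartial-≤-powers : ∀ {a b r} M K → 0ℚ ≤ a → 0ℚ ≤ b → 0ℚ ≤ r → r ≤ 1ℚ →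
                        1ℚ ≤ a * (1ℚ - r) → 1ℚ ≤ b * (1ℚ - r) → expPartial K (ι (M ℕ.+ M) * r) ≤ a ^ℚ M * b ^ℚ M
  expPartial-≤-powers {a} {b} {r} M K 0≤a 0≤b 0≤r r≤1 1≤a[1-r] 1≤b[1-r] = begin
    E                                             ≡⟨ *-identityʳ E ⟨
    E * 1ℚ                                        ≤⟨ *-monoˡ-≤-≥0 (expPartial-≥0 K (*-≥0 (0≤ι (M ℕ.+ M)) 0≤r))
                                                       (*-mono-≤-≥0 0≤1 0≤1 (1≤^ℚ M 1≤a[1-r]) (1≤^ℚ M 1≤b[1-r])) ⟩
    E * ((a * (1ℚ - r)) ^ℚ M * (b * (1ℚ - r)) ^ℚ M)  ≡⟨ cong₂ (λ x y → E * (x * y)) (*-^ℚ a _ M) (*-^ℚ b _ M) ⟩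
    E * ((a ^ℚ M * d) * (b ^ℚ M * d))             ≡⟨ regroup E (a ^ℚ M) (b ^ℚ M) d ⟩
    (E * (d * d)) * (a ^ℚ M * b ^ℚ M)             ≡⟨ cong (λ x → (E * x) * (a ^ℚ M * b ^ℚ M)) (^ℚ-+ (1ℚ - r) M M) ⟨
    (E * (1ℚ - r) ^ℚ (M ℕ.+ M)) * (a ^ℚ M * b ^ℚ M)
                                                  ≤⟨ *-monoʳ-≤-≥0 (*-≥0 (^ℚ-≥0 M 0≤a) (^ℚ-≥0 M 0≤b))
                                                       (expPartial*[1-r]^L≤1 (M ℕ.+ M) K 0≤r r≤1) ⟩
    1ℚ * (a ^ℚ M * b ^ℚ M)                        ≡⟨ *-identityˡ _ ⟩
    a ^ℚ M * b ^ℚ M                               ∎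
    where
    open ≤-Reasoning
    open +-*-Solver
    E = expPartial K (ι (M ℕ.+ M) * r)
    d = (1ℚ - r) ^ℚ M
    regroup : ∀ e x y d → e * ((x * d) * (y * d)) ≡ (e * (d * d)) * (x * y)
    regroup = solve 4 (λ e x y d → e :* ((x :* d) :* (y :* d)) := (e :* (d :* d)) :* (x :* y)) refl

  module Weights (n : ℕ) {ε μ : ℚ} (0≤μ : 0ℚ ≤ μ) (0≤ε : 0ℚ ≤ ε) (ε≤1 : ε ≤ 1ℚ)
                 (2ⁿμ≡1 : ι 2 ^ℚ n * μ ≡ 1ℚ) (2[n+2]μ≤ε : (ι (n ℕ.+ 2) + ι (n ℕ.+ 2)) * μ ≤ ε) where
    open +-*-Solver

    r ν : ℚ
    r = (1ℚ - ε) * μ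
    ν = r * (1ℚ + (r + r))

    private
      s = ι (n ℕ.+ 2) + ι (n ℕ.+ 2)

      1≤ι[n+2] : 1ℚ ≤ ι (n ℕ.+ 2)
      1≤ι[n+2] = ι-mono-≤ {1} (ℕ.≤-trans (ℕ.n≤1+n 1) (ℕ.m≤n+m 2 n))

      2μ≤sμ : μ + μ ≤ s * μ
      2μ≤sμ = ≤-trans (≤-reflexive (solve 1 (λ μ → μ :+ μ := (con 1ℚ :+ con 1ℚ) :* μ) refl μ))
                      (*-monoʳ-≤-≥0 0≤μ (+-mono-≤ 1≤ι[n+2] 1≤ι[n+2]))

      sμ≤1 : s * μ ≤ 1ℚ
      sμ≤1 = ≤-trans 2[n+2]μ≤ε ε≤1

      0≤1-ε : 0ℚ ≤ 1ℚ - ε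
      0≤1-ε = p≤q⇒0≤q-p ε≤1

      1-ε≤1 : 1ℚ - ε ≤ 1ℚ
      1-ε≤1 = ≤-trans (p≤p+q 0≤ε) (≤-reflexive (solve 1 (λ ε → (con 1ℚ :- ε) :+ ε := con 1ℚ) refl ε))

      [1-ε][1+ε]≤1 : (1ℚ - ε) * (1ℚ + ε) ≤ 1ℚ
      [1-ε][1+ε]≤1 = ≤-trans (p≤p+q (*-≥0 0≤ε 0≤ε))
        (≤-reflexive (solve 1 (λ ε → (con 1ℚ :- ε) :* (con 1ℚ :+ ε) :+ ε :* ε := con 1ℚ) refl ε))

    μ≤ε : μ ≤ ε
    μ≤ε = ≤-trans (≤-trans (p≤p+q 0≤μ) 2μ≤sμ) 2[n+2]μ≤ε

    0≤r : 0ℚ ≤ r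
    0≤r = *-≥0 0≤1-ε 0≤μ

    r≤μ : r ≤ μ
    r≤μ = ≤-trans (*-monoʳ-≤-≥0 0≤μ 1-ε≤1) (≤-reflexive (*-identityˡ μ))

    2r≤1 : r + r ≤ 1ℚ
    2r≤1 = ≤-trans (+-mono-≤ r≤μ r≤μ) (≤-trans 2μ≤sμ sμ≤1)

    r≤1 : r ≤ 1ℚ
    r≤1 = ≤-trans (p≤p+q 0≤r) 2r≤1

    0≤ν : 0ℚ ≤ ν
    0≤ν = *-≥0 0≤r (≤-trans 0≤1 (p≤p+q (+-mono-≤ 0≤r 0≤r)))

    1≤[1+μ][1-r] : 1ℚ ≤ (1ℚ + μ) * (1ℚ - r)
    1≤[1+μ][1-r] = ≤-trans (p≤p+q (*-≥0 0≤μ (p≤q⇒0≤q-p (≤-trans r≤μ μ≤ε))))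
      (≤-reflexive (solve 2 (λ μ ε → con 1ℚ :+ μ :* (ε :- (con 1ℚ :- ε) :* μ)
                                  := (con 1ℚ :+ μ) :* (con 1ℚ :- (con 1ℚ :- ε) :* μ)) refl μ ε))

    1≤[1+ν][1-r] : 1ℚ ≤ (1ℚ + ν) * (1ℚ - r)
    1≤[1+ν][1-r] = ≤-trans (p≤p+q (*-≥0 (*-≥0 0≤r 0≤r) (p≤q⇒0≤q-p 2r≤1)))
      (≤-reflexive (solve 1 (λ r → con 1ℚ :+ (r :* r) :* (con 1ℚ :- (r :+ r))
                                := (con 1ℚ :+ r :* (con 1ℚ :+ (r :+ r))) :* (con 1ℚ :- r)) refl r))

    2ⁿ[1+μ]ⁿν≤1 : (ι 2 ^ℚ n * (1ℚ + μ) ^ℚ n) * ν ≤ 1ℚ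
    2ⁿ[1+μ]ⁿν≤1 = begin
      (ι 2 ^ℚ n * p) * ν                            ≡⟨ regroup (ι 2 ^ℚ n) p (1ℚ - ε) μ ⟩
      (ι 2 ^ℚ n * μ) * ((1ℚ - ε) * ((1ℚ + (r + r)) * p))
                                                    ≡⟨ trans (cong (_* ((1ℚ - ε) * ((1ℚ + (r + r)) * p))) 2ⁿμ≡1) (*-identityˡ _) ⟩
      (1ℚ - ε) * ((1ℚ + (r + r)) * p)               ≤⟨ *-monoˡ-≤-≥0 0≤1-ε (*-monoʳ-≤-≥0 (^ℚ-≥0 n 0≤1+μ) 1+2r≤[1+μ]²) ⟩
      (1ℚ - ε) * ((1ℚ + μ) ^ℚ 2 * p)                ≡⟨ cong ((1ℚ - ε) *_) (trans (*-comm _ p) (sym (^ℚ-+ (1ℚ + μ) n 2))) ⟩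
      (1ℚ - ε) * (1ℚ + μ) ^ℚ (n ℕ.+ 2)              ≤⟨ *-monoˡ-≤-≥0 0≤1-ε ([1+μ]^j≤1+2jμ (n ℕ.+ 2) 0≤μ sμ≤1) ⟩
      (1ℚ - ε) * (1ℚ + s * μ)                       ≤⟨ *-monoˡ-≤-≥0 0≤1-ε (+-monoʳ-≤ 1ℚ 2[n+2]μ≤ε) ⟩
      (1ℚ - ε) * (1ℚ + ε)                           ≤⟨ [1-ε][1+ε]≤1 ⟩
      1ℚ                                            ∎
      where
      open ≤-Reasoning
      p = (1ℚ + μ) ^ℚ n
      0≤1+μ : 0ℚ ≤ 1ℚ + μ
      0≤1+μ = ≤-trans 0≤1 (p≤p+q 0≤μ)
      1+2r≤[1+μ]² : 1ℚ + (r + r) ≤ (1ℚ + μ) ^ℚ 2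
      1+2r≤[1+μ]² = ≤-trans (+-monoʳ-≤ 1ℚ (+-mono-≤ r≤μ r≤μ))
        (≤-trans (p≤p+q (*-≥0 0≤μ 0≤μ))
          (≤-reflexive (solve 1 (λ μ → (con 1ℚ :+ (μ :+ μ)) :+ μ :* μ := (con 1ℚ :+ μ) :* ((con 1ℚ :+ μ) :* con 1ℚ)) refl μ)))
      regroup : ∀ w p c μ → (w * p) * ((c * μ) * (1ℚ + ((c * μ) + (c * μ)))) ≡ (w * μ) * (c * ((1ℚ + ((c * μ) + (c * μ))) * p))
      regroup = solve 4 (λ w p c μ → (w :* p) :* ((c :* μ) :* (con 1ℚ :+ ((c :* μ) :+ (c :* μ))))
                                  := (w :* μ) :* (c :* ((con 1ℚ :+ ((c :* μ) :+ (c :* μ))) :* p))) refl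

module _ where
  open import Data.Integer using (+_)
  open import Data.Nat using (_≤_; _%_; _/_; _^_; _*_)
  open import Data.Rational using (_+_; _-_; _<_)
  open import Data.Rational.Properties using (≤-trans; ≤-reflexive; *-assoc)

  ½ : ℚ
  ½ = + 1 ℚ./ 2

  0≤½ : 0ℚ ℚ.≤ ½
  0≤½ = ℚ.*≤* (ℤ.+≤+ z≤n)

  2ⁿ½ⁿ≡1 : ∀ n → ι 2 ^ℚ n ℚ.* ½ ^ℚ n ≡ 1ℚ
  2ⁿ½ⁿ≡1 n = trans (sym (*-^ℚ (ι 2) ½ n)) (1^ℚ n)
    where
    1^ℚ : ∀ k → 1ℚ ^ℚ k ≡ 1ℚ
    1^ℚ zero    = refl
    1^ℚ (suc k) = trans (ℚ.*-identityˡ _) (1^ℚ k)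

  m/2≡m*½ : ∀ m → + m ℚ./ 2 ≡ ι m ℚ.* ½
  m/2≡m*½ m = *-cancelʳ-≡ (ι 2) {{ι-pos 2}} (trans (/-*-ι m 2)
    (sym (trans (*-assoc (ι m) ½ (ι 2)) (ℚ.*-identityʳ (ι m)))))

  [n+2+n+2]n≤2ⁿ : ∀ {n} → 7 ≤ n → (n ℕ.+ 2 ℕ.+ (n ℕ.+ 2)) * n ≤ 2 ^ n
  [n+2+n+2]n≤2ⁿ 7≤n with ℕ.m≤n⇒∃[o]m+o≡n 7≤n
  ... | t , refl = growth t
    where
    growth : ∀ t → let n = 7 ℕ.+ t in (n ℕ.+ 2 ℕ.+ (n ℕ.+ 2)) * n ≤ 2 ^ n
    growth zero    = ℕ.m≤m+n 126 2
    growth (suc t) = ℕ.≤-trans (ℕ.m≤m+n _ (92 ℕ.+ 28 * t ℕ.+ 2 * t * t))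
      (ℕ.≤-trans (ℕ.≤-reflexive (identity t)) (ℕ.*-monoʳ-≤ 2 (growth t)))
      where
      -- 92 + 28t + 2t² = 2s² - 6 for s = 7 + t, the slack in (2s + 6)(s + 1) ≤ 2 (2s + 4) s
      identity : ∀ t → let s = 7 ℕ.+ t in
        (suc s ℕ.+ 2 ℕ.+ (suc s ℕ.+ 2)) * suc s ℕ.+ (92 ℕ.+ 28 * t ℕ.+ 2 * t * t) ≡ 2 * ((s ℕ.+ 2 ℕ.+ (s ℕ.+ 2)) * s)
      identity = ℕ-Solver.solve-∀

  archimedean : ∀ ε → 0ℚ < ε → 1ℚ ℚ.≤ ε ℚ.* ι (ℚ.↧ₙ ε)
  archimedean ε@(mkℚ (+ suc k) d _) _ = ≤-trans (ι-mono-≤ {1} {suc k} (s≤s z≤n))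
    (≤-reflexive (sym (trans (cong (ℚ._* ι (suc d)) (sym (ℚ.↥p/↧p≡p ε))) (/-*-ι (suc k) (suc d)))))
  archimedean (mkℚ (+ zero)    _ _) (ℚ.*<* (ℤ.+<+ ()))
  archimedean (mkℚ ℤ.-[1+ _ ] _ _) (ℚ.*<* ())

  ½ⁿ-small : ∀ {ε} q .{{_ : NonZero q}} {n} → 1ℚ ℚ.≤ ε ℚ.* ι q → q ≤ n → 7 ≤ n →
             (ι (n ℕ.+ 2) + ι (n ℕ.+ 2)) ℚ.* ½ ^ℚ n ℚ.≤ ε
  ½ⁿ-small {ε} q {n} 1≤εq q≤n 7≤n = ℚ.*-cancelʳ-≤-pos (ι q) {{ι-pos q}} (begin
    ((ι (n ℕ.+ 2) + ι (n ℕ.+ 2)) ℚ.* ½ ^ℚ n) ℚ.* ι q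
      ≡⟨ swap (ι (n ℕ.+ 2) + ι (n ℕ.+ 2)) (½ ^ℚ n) (ι q) ⟩
    ((ι (n ℕ.+ 2) + ι (n ℕ.+ 2)) ℚ.* ι q) ℚ.* ½ ^ℚ n
      ≡⟨ cong (ℚ._* ½ ^ℚ n) (trans (cong (ℚ._* ι q) (sym (ι-+ (n ℕ.+ 2) (n ℕ.+ 2)))) (sym (ι-* (n ℕ.+ 2 ℕ.+ (n ℕ.+ 2)) q))) ⟩
    ι ((n ℕ.+ 2 ℕ.+ (n ℕ.+ 2)) * q) ℚ.* ½ ^ℚ n
      ≤⟨ *-monoʳ-≤-≥0 (^ℚ-≥0 n 0≤½)
           (ι-mono-≤ (ℕ.≤-trans (ℕ.*-monoʳ-≤ (n ℕ.+ 2 ℕ.+ (n ℕ.+ 2)) q≤n) ([n+2+n+2]n≤2ⁿ 7≤n))) ⟩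
    ι (2 ^ n) ℚ.* ½ ^ℚ n
      ≡⟨ trans (cong (ℚ._* ½ ^ℚ n) (ι-^ 2 n)) (2ⁿ½ⁿ≡1 n) ⟩
    1ℚ
      ≤⟨ 1≤εq ⟩
    ε ℚ.* ι q ∎)
    where
    open ℚ.≤-Reasoning
    swap : ∀ a b c → (a ℚ.* b) ℚ.* c ≡ (a ℚ.* c) ℚ.* b
    swap = solve 3 (λ a b c → (a :* b) :* c := (a :* c) :* b) refl
      where open +-*-Solver

  module _ (m : ℕ) .{{_ : NonZero m}} (3≤m : 3 ≤ m) (m-odd : m % 2 ≡ 1) (n : ℕ) where
    open IndependentSets (adjacent? m (suc n))
    open Layering (adjacent? m (suc n))
    open TorusLayers m 3≤m (suc n)
    open Torus m using (IsB?; level-count; level-set-count; #B-levels)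

    numIndep-≥-weights : ∀ {μ ν} → 0ℚ ℚ.≤ μ → 0ℚ ℚ.≤ ν → ι 2 ^ℚ suc n ℚ.* μ ℚ.≤ 1ℚ →
      (ι 2 ^ℚ suc n ℚ.* (1ℚ ℚ.+ μ) ^ℚ suc n) ℚ.* ν ℚ.≤ 1ℚ →
      (ι 2 ^ℚ (m / 2 * m ^ n) ℚ.* (1ℚ ℚ.+ μ) ^ℚ (m ^ n)) ℚ.* (1ℚ ℚ.+ ν) ^ℚ (m ^ n) ℚ.≤ ι (numIndep m (suc n))
    numIndep-≥-weights {μ} {ν} 0≤μ 0≤ν 2ⁿμ≤1 2ⁿ[1+μ]ⁿν≤1 = begin
      (ι 2 ^ℚ (m / 2 * m ^ n) ℚ.* (1ℚ ℚ.+ μ) ^ℚ (m ^ n)) ℚ.* (1ℚ ℚ.+ ν) ^ℚ (m ^ n)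
        ≡⟨ cong₂ (λ b p → (ι 2 ^ℚ b ℚ.* (1ℚ ℚ.+ μ) ^ℚ p) ℚ.* (1ℚ ℚ.+ ν) ^ℚ (m ^ n)) |Bs| |Ps| ⟨
      (ι 2 ^ℚ count all Bs ℚ.* (1ℚ ℚ.+ μ) ^ℚ count all Ps) ℚ.* (1ℚ ℚ.+ ν) ^ℚ (m ^ n)
        ≡⟨ cong (λ q → (ι 2 ^ℚ count all Bs ℚ.* (1ℚ ℚ.+ μ) ^ℚ count all Ps) ℚ.* (1ℚ ℚ.+ ν) ^ℚ q) |Qs| ⟨
      (ι 2 ^ℚ count all Bs ℚ.* (1ℚ ℚ.+ μ) ^ℚ count all Ps) ℚ.* (1ℚ ℚ.+ ν) ^ℚ count all Qs
        ≤⟨ three-layers Qs Ps Bs Rs (suc n) 0≤μ 0≤ν 2ⁿμ≤1 2ⁿ[1+μ]ⁿν≤1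
             Qs-independent Ps-independent Bs-independent deg-P-B deg-Q all ⟩
      ι (indepCount (Qs ++ Ps ++ Bs ++ Rs) all)
        ≡⟨ cong ι (indepCount-↭ Vs↭QPBR all) ⟨
      ι (indepCount Vs all)
        ≡⟨ cong ι (count-Independent (isIndependent? m (suc n)) Vs) ⟨
      ι (numIndep m (suc n)) ∎
      where
      open ℚ.≤-Reasoning
      all : Vertex m (suc n) → Bool
      all _ = true
      |Qs| : count all Qs ≡ m ^ n
      |Qs| = trans (count-true Qs) (level-count n (ℕ.∸-monoʳ-< {o = 0} (s≤s z≤n) (ℕ.≤-trans (s≤s z≤n) 3≤m)))
      |Ps| : count all Ps ≡ m ^ n
      |Ps| = trans (count-true Ps) (level-count n (ℕ.∸-monoʳ-< {o = 0} (s≤s z≤n) 2≤m))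
      |Bs| : count all Bs ≡ m / 2 * m ^ n
      |Bs| = trans (count-true Bs) (trans (level-set-count n IsB?) (cong (_* m ^ n) (#B-levels m-odd)))

  module _ (m : ℕ) .{{_ : NonZero m}} (3≤m : 3 ≤ m) (m-odd : m % 2 ≡ 1) (n : ℕ) {ε : ℚ}
           (0≤ε : 0ℚ ℚ.≤ ε) (ε≤1 : ε ℚ.≤ 1ℚ)
           (small : (ι (suc n ℕ.+ 2) + ι (suc n ℕ.+ 2)) ℚ.* ½ ^ℚ suc n ℚ.≤ ε) where
    open Weights (suc n) (^ℚ-≥0 (suc n) 0≤½) 0≤ε ε≤1 (2ⁿ½ⁿ≡1 (suc n)) small

    numIndep-≥-exp : ∀ K → ι (2 ^ (m / 2 * m ^ n)) ℚ.* expPartial K ((1ℚ - ε) ℚ.* (+ m ℚ./ 2) ^ℚ n)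
                           ℚ.≤ ι (numIndep m (suc n))
    numIndep-≥-exp K = begin
      ι (2 ^ (m / 2 * M)) ℚ.* expPartial K ((1ℚ - ε) ℚ.* (+ m ℚ./ 2) ^ℚ n)
        ≡⟨ cong₂ (λ a x → a ℚ.* expPartial K x) (ι-^ 2 (m / 2 * M)) [1-ε][m/2]ⁿ≡2Mr ⟩
      ι 2 ^ℚ (m / 2 * M) ℚ.* expPartial K (ι (M ℕ.+ M) ℚ.* r)
        ≤⟨ *-monoˡ-≤-≥0 (^ℚ-≥0 (m / 2 * M) (0≤ι 2))
             (expPartial-≤-powers M K (≤-trans 0≤1 (p≤p+q 0≤μ)) (≤-trans 0≤1 (p≤p+q 0≤ν)) 0≤r r≤1
                                  1≤[1+μ][1-r] 1≤[1+ν][1-r]) ⟩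
      ι 2 ^ℚ (m / 2 * M) ℚ.* ((1ℚ + μ) ^ℚ M ℚ.* (1ℚ + ν) ^ℚ M)
        ≡⟨ *-assoc (ι 2 ^ℚ (m / 2 * M)) ((1ℚ + μ) ^ℚ M) ((1ℚ + ν) ^ℚ M) ⟨
      (ι 2 ^ℚ (m / 2 * M) ℚ.* (1ℚ + μ) ^ℚ M) ℚ.* (1ℚ + ν) ^ℚ M
        ≤⟨ numIndep-≥-weights m 3≤m m-odd n 0≤μ 0≤ν (≤-reflexive (2ⁿ½ⁿ≡1 (suc n))) 2ⁿ[1+μ]ⁿν≤1 ⟩
      ι (numIndep m (suc n)) ∎
      where
      open ℚ.≤-Reasoning
      M = m ^ n
      μ = ½ ^ℚ suc n
      0≤μ : 0ℚ ℚ.≤ μ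
      0≤μ = ^ℚ-≥0 (suc n) 0≤½
      [1-ε][m/2]ⁿ≡2Mr : (1ℚ - ε) ℚ.* (+ m ℚ./ 2) ^ℚ n ≡ ι (M ℕ.+ M) ℚ.* r
      [1-ε][m/2]ⁿ≡2Mr = begin-equality
        (1ℚ - ε) ℚ.* (+ m ℚ./ 2) ^ℚ n             ≡⟨ cong (λ x → (1ℚ - ε) ℚ.* x ^ℚ n) (m/2≡m*½ m) ⟩
        (1ℚ - ε) ℚ.* (ι m ℚ.* ½) ^ℚ n             ≡⟨ cong ((1ℚ - ε) ℚ.*_)
                                                       (trans (*-^ℚ (ι m) ½ n) (cong (ℚ._* ½ ^ℚ n) (sym (ι-^ m n)))) ⟩
        (1ℚ - ε) ℚ.* (ι M ℚ.* ½ ^ℚ n)             ≡⟨ ℚ.*-identityʳ _ ⟨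
        ((1ℚ - ε) ℚ.* (ι M ℚ.* ½ ^ℚ n)) ℚ.* ((1ℚ + 1ℚ) ℚ.* ½)
                                                  ≡⟨ regroup (ι M) (1ℚ - ε) (½ ^ℚ n) ½ ⟩
        (ι M + ι M) ℚ.* ((1ℚ - ε) ℚ.* (½ ℚ.* ½ ^ℚ n)) ≡⟨ cong (ℚ._* r) (ι-+ M M) ⟨
        ι (M ℕ.+ M) ℚ.* r                         ∎
        where
        open +-*-Solver
        regroup : ∀ x c p h → (c ℚ.* (x ℚ.* p)) ℚ.* ((1ℚ + 1ℚ) ℚ.* h) ≡ (x + x) ℚ.* (c ℚ.* (h ℚ.* p))
        regroup = solve 4 (λ x c p h → (c :* (x :* p)) :* ((con 1ℚ :+ con 1ℚ) :* h) := (x :+ x) :* (c :* (h :* p))) refl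

open import Data.Nat using (ℕ; NonZero; _≤_; _%_; _/_; _^_; _*_; _∸_)
open import Data.Integer using (+_)
open import Data.Rational using (ℚ; 0ℚ; 1ℚ; _<_; _-_)
import Data.Rational as Q

theorem1p2 : (m : ℕ) .{{_ : NonZero m}} → 3 ≤ m → m % 2 ≡ 1 →
    (ε : ℚ) → 0ℚ < ε → ε Q.≤ 1ℚ →
    ∃[ N ] ((n : ℕ) → N ≤ n → (K : ℕ) →
      ((+ (2 ^ ((m / 2) * m ^ (n ∸ 1)))) Q./ 1)
        Q.* expPartial K ((1ℚ - ε) Q.* (((+ m) Q./ 2) ^ℚ (n ∸ 1)))
      Q.≤ ((+ numIndep m n) Q./ 1))
theorem1p2 m 3≤m m-odd ε 0<ε ε≤1 = q ℕ.+ 7 , bound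
  where
  q = Q.↧ₙ ε
  bound : (n : ℕ) → q ℕ.+ 7 ≤ n → (K : ℕ) →
          ι (2 ^ (m / 2 * m ^ (n ∸ 1))) Q.* expPartial K ((1ℚ - ε) Q.* (+ m Q./ 2) ^ℚ (n ∸ 1))
          Q.≤ ι (numIndep m n)
  bound zero    q+7≤0 with () ← ℕ.m+n≤o⇒n≤o q q+7≤0
  bound (suc n) q+7≤n = numIndep-≥-exp m 3≤m m-odd n (ℚ.<⇒≤ 0<ε) ε≤1
    (½ⁿ-small q (archimedean ε 0<ε) (ℕ.m+n≤o⇒m≤o q q+7≤n) (ℕ.m+n≤o⇒n≤o q q+7≤n))
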